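{- Let $m \in \mathbb{N}$, $s_1, \dots, s_m \in \mathbb{N}_0$. Then for any positive integer $n$, $$H_n^*[\{2\}^{s_1}, 1, \{2\}^{s_2}, 1, \dots, \{2\}^{s_m}, 1] = \sum_{\mathbf{p}=(2s_1+1)\circ(2s_2+1)\circ\dots\circ(2s_m+1)} \widehat{\mathcal{H}}_n[\mathbf{p}; \widetilde{\mathbf{p}}],$$ where $\circ$ is either comma or plus, and the string $\widetilde{\mathbf{p}} := (s_1 + 1) \circ (s_2 + 1) \circ \dots \circ (s_m + 1)$ is associated with the string $\mathbf{p}$, i.e. the choice of commas and pluses in $\mathbf{p}$ and $\widetilde{\mathbf{p}}$ is the same.
   Context: Let $0<q<1$, $[n]_q = \frac{1-q^n}{1-q}$, $(q)_n=\prod_{k=0}^{n-1}(1-q^{k+1})$, and $\begin{bmatrix} n \\ m \end{bmatrix} = \frac{(q)_n}{(q)_m (q)_{n-m}}$ for $0\le m\le n$, $0$ otherwise. For non-negative integers $n,m$ and $\mathbf{s}=(s_1,\dots,s_m)$, $\mathbf{t}=(t_1,\dots,t_m)\in\mathbb{Z}^m$ define $H_n^*[\mathbf{s}] = \sum_{n \geq k_1 \geq \dots \geq k_m \geq 1} \prod_{j=1}^m \frac{q^{k_j}}{[k_j]_q^{s_j}}$, $\mathcal{H}_n[\mathbf{s};\mathbf{t}] = \sum_{n \geq k_1 > \dots > k_m \geq 1} \prod_{j=1}^m \frac{q^{(t_j-1)k_j}(1+q^{k_j})}{[k_j]_q^{s_j}}$ (zero if $n<m$; equal to $1$ for $m=0$),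 and $\widehat{\mathcal{H}}_n[\mathbf{s}; \mathbf{t}] = \sum_{k=1}^n \frac{\begin{bmatrix} n \\ k \end{bmatrix}}{\begin{bmatrix} n+k \\ k \end{bmatrix}} \frac{q^{k^2+(t_1-1)k}(1+q^k)}{[k]_q^{s_1}} \mathcal{H}_{k-1}[s_2, \dots, s_m; t_2, \dots, t_m]$, with $\widehat{\mathcal{H}}_n[\mathbf{s};\mathbf{t}]=0$ if $n<m$ and $=1$ if $m=0$. $\{2\}^a$ denotes $a$ consecutive 2's.
   Formalization: The parameter q ranges over the rationals with 0<q<1 rather than over the real numbers in that interval. -}

module Defs where

open import Data.Bool using (Bool; true; false; if_then_else_)
open import Data.Nat as ℕ using (ℕ; zero; suc)
open import Data.Integer as ℤ using (ℤ; +_; -[1+_])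
open import Data.Rational using (ℚ; mkℚ; 0ℚ; 1ℚ; _+_; _*_; _-_; 1/_)
open import Data.List using (List; []; _∷_; _++_; replicate)
open import Data.Vec using (Vec; []; _∷_)
open import Data.Product using (_×_; _,_)

-- Total inverse on ℚ (convention 1/0 := 0); only ever applied to nonzero
-- values in the statement since 0 < q < 1.
inv : ℚ → ℚ
inv (mkℚ (+ zero) _ _)    = 0ℚ
inv p@(mkℚ (+ suc _) _ _) = 1/ p
inv p@(mkℚ -[1+ _ ] _ _)  = 1/ p

_^_ : ℚ → ℕ → ℚ
x ^ zero  = 1ℚ
x ^ suc n = x * (x ^ n)

_^ℤ_ : ℚ → ℤ → ℚ
x ^ℤ (+ n)    = x ^ n
x ^ℤ -[1+ n ] = inv (x ^ suc n)

Σ1 : ℕ → (ℕ → ℚ) → ℚ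
Σ1 zero    f = 0ℚ
Σ1 (suc n) f = Σ1 n f + f (suc n)

module _ (q : ℚ) where

  qint : ℕ → ℚ
  qint n = (1ℚ - q ^ n) * inv (1ℚ - q)

  qpoch : ℕ → ℚ
  qpoch zero    = 1ℚ
  qpoch (suc n) = qpoch n * (1ℚ - q ^ suc n)

  qbinom : ℕ → ℕ → ℚ
  qbinom n m = if m ℕ.≤ᵇ n
               then qpoch n * inv (qpoch m * qpoch (n ℕ.∸ m))
               else 0ℚ

  -- H*_n[s] = Σ_{n ≥ k₁ ≥ … ≥ k_m ≥ 1} ∏ q^{k_j} / [k_j]^{s_j}
  Hstar : ℕ → List ℤ → ℚ
  Hstar n []       = 1ℚ
  Hstar n (s ∷ ss) = Σ1 n (λ k → q ^ k * inv (qint k ^ℤ s) * Hstar k ss)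

  term : ℤ → ℤ → ℕ → ℚ
  term s t k = q ^ℤ ((t ℤ.- ℤ.+ 1) ℤ.* (+ k)) * (1ℚ + q ^ k) * inv (qint k ^ℤ s)

  -- 𝓗_n[s;t] = Σ_{n ≥ k₁ > … > k_m ≥ 1} ∏ term; list of pairs (s_j , t_j)
  calH : ℕ → List (ℤ × ℤ) → ℚ
  calH n []             = 1ℚ
  calH n ((s , t) ∷ st) = Σ1 n (λ k → term s t k * calH (k ℕ.∸ 1) st)

  hatH : ℕ → List (ℤ × ℤ) → ℚ
  hatH n []             = 1ℚ
  hatH n ((s , t) ∷ st) =
    Σ1 n (λ k → qbinom n k * inv (qbinom (n ℕ.+ k) k)
                * (q ^ (k ℕ.* k) * term s t k) * calH (k ℕ.∸ 1) st)

twosOnes : ∀ {m} → Vec ℕ m → List ℤ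
twosOnes []       = []
twosOnes (s ∷ ss) = replicate s (+ 2) ++ ((+ 1) ∷ twosOnes ss)

-- Gluing a string x₁ ∘ x₂ ∘ … ∘ x_{m'+1}: the i-th Boolean says whether
-- the i-th ∘ is a plus (true) or a comma (false). Pairs are glued
-- componentwise, so p and p̃ use the same choice of commas and pluses.
glue : ∀ {m} → ℤ × ℤ → Vec (ℤ × ℤ) m → Vec Bool m → List (ℤ × ℤ)
glue x       []       []           = x ∷ []
glue (a , b) ((c , d) ∷ xs) (true ∷ bs)  = glue (a ℤ.+ c , b ℤ.+ d) xs bs
glue x       (y ∷ xs) (false ∷ bs) = x ∷ glue y xs bs

ΣBools : (m : ℕ) → (Vec Bool m → ℚ) → ℚ
ΣBools zero    f = f []
ΣBools (suc m) f = ΣBools m (λ v → f (true ∷ v)) + ΣBools m (λ v → f (false ∷ v))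

pt : ℕ → ℤ × ℤ
pt s = (+ (2 ℕ.* s ℕ.+ 1) , + (s ℕ.+ 1))

ptVec : ∀ {m} → Vec ℕ m → Vec (ℤ × ℤ) m
ptVec []       = []
ptVec (s ∷ ss) = pt s ∷ ptVec ss

-- Peeling off the leading block {2}^s,1 writes H*_n as a nested sum
-- Σ_{n ≥ l₁ ≥ ⋯ ≥ l_s ≥ l} w₂(l₁)⋯w₂(l_s) w₁(l) f(l) of the H*_l of the remaining string.
-- The key identity evaluates this nested sum on the coefficients ρ(l,k) = [l k]/[l+k k] of the
-- hat-sums: q^{k²} Σ … ρ(l,k) = ρ(n,k) q^{k²+(s+1)k}/[k]^{2s+1} + Σ_{k<j≤n} ρ(n,j) q^{j²+sj}(1+q^j)/[j]^{2s+1}.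
-- Both sides satisfy the recursions of the nested sum in s and n; this rests on
-- ρ(n+1,j) (w₂(j) - w₂(n+1)) = ρ(n,j) w₂(j) and, for s = 0, on a telescoping sum.
-- Inserting it into the summands of \hat𝓗_l[p;p̃], the first term glues (2s+1, s+1) onto the first
-- part of p by a plus, and the second, after exchanging the order of summation, puts it in front by
-- a comma. Induction on m then produces the sum over all choices of the ∘'s.

module Submission where

open import Defs
open import Data.Bool using (Bool; true; false; if_then_else_; T)
open import Data.Empty using (⊥-elim)
open import Data.Integer as ℤ using (ℤ; +_; -[1+_])
import Data.Integer.Properties as ℤP
open import Data.List using (List; []; _∷_; _++_; replicate)
open import Data.Nat as ℕ using (ℕ; zero; suc; z≤n; s≤s; _≥_)
import Data.Nat.Properties as ℕP
open import Data.Product using (_,_; Σ-syntax; _×_)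
open import Data.Rational as ℚ using (ℚ; mkℚ; 0ℚ; 1ℚ; _+_; _*_; _-_; -_; 1/_; _<_)
import Data.Rational.Properties as ℚP
open import Data.Rational.Solver using (module +-*-Solver)
open import Data.Sum using (_⊎_; inj₁; inj₂)
open import Data.Unit using (tt)
open import Data.Vec using (Vec; []; _∷_)
open import Relation.Nullary using (yes; no)
open import Relation.Binary.PropositionalEquality
open import Algebra.Bundles using (CommutativeRing)
open CommutativeRing ℚP.+-*-commutativeRing using (+-commutativeSemigroup; *-commutativeSemigroup)
open import Algebra.Properties.CommutativeSemigroup +-commutativeSemigroup
  using () renaming (interchange to +-interchange)
open import Algebra.Properties.CommutativeSemigroup *-commutativeSemigroup
  using () renaming (interchange to *-interchange; x∙yz≈y∙xz to *-left-comm)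

open +-*-Solver using (solve; _:+_; _:*_; _:-_; con; _:=_)
open ≡-Reasoning

inv-inverseʳ : ∀ x → x ≢ 0ℚ → x * inv x ≡ 1ℚ
inv-inverseʳ (mkℚ (+ zero) _ _) x≢0 = ⊥-elim (ℕ.NonZero.nonZero (ℚ.≢-nonZero x≢0))
inv-inverseʳ x@(mkℚ (+ suc _) _ _) _ = ℚP.*-inverseʳ x
inv-inverseʳ x@(mkℚ -[1+ _ ] _ _) _ = ℚP.*-inverseʳ x

inv-inverseˡ : ∀ x → x ≢ 0ℚ → inv x * x ≡ 1ℚ
inv-inverseˡ x x≢0 = trans (ℚP.*-comm (inv x) x) (inv-inverseʳ x x≢0)

inv-unique : ∀ x y → x * y ≡ 1ℚ → inv x ≡ y
inv-unique x y xy≡1 with x ℚP.≟ 0ℚ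
... | yes refl = ⊥-elim (1≢0 (trans (sym xy≡1) (ℚP.*-zeroˡ y)))
  where 1≢0 : 1ℚ ≢ 0ℚ
        1≢0 ()
... | no x≢0 = begin
  inv x             ≡⟨ sym (ℚP.*-identityʳ (inv x)) ⟩
  inv x * 1ℚ        ≡⟨ cong (inv x *_) (sym xy≡1) ⟩
  inv x * (x * y)   ≡⟨ sym (ℚP.*-assoc (inv x) x y) ⟩
  (inv x * x) * y   ≡⟨ cong (_* y) (inv-inverseˡ x x≢0) ⟩
  1ℚ * y            ≡⟨ ℚP.*-identityˡ y ⟩
  y                 ∎

inv-distrib-* : ∀ x y → inv (x * y) ≡ inv x * inv y
inv-distrib-* x y with x ℚP.≟ 0ℚ | y ℚP.≟ 0ℚ
... | yes refl | _ = trans (cong inv (ℚP.*-zeroˡ y)) (sym (ℚP.*-zeroˡ (inv y)))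
... | no _ | yes refl = trans (cong inv (ℚP.*-zeroʳ x)) (sym (ℚP.*-zeroʳ (inv x)))
... | no x≢0 | no y≢0 = inv-unique (x * y) (inv x * inv y) (begin
  (x * y) * (inv x * inv y)   ≡⟨ *-interchange x y (inv x) (inv y) ⟩
  (x * inv x) * (y * inv y)   ≡⟨ cong₂ _*_ (inv-inverseʳ x x≢0) (inv-inverseʳ y y≢0) ⟩
  1ℚ                          ∎)

inv-involutive : ∀ x → inv (inv x) ≡ x
inv-involutive x with x ℚP.≟ 0ℚ
... | yes refl = refl
... | no x≢0 = inv-unique (inv x) x (inv-inverseˡ x x≢0)

inv-pos : ∀ {x} → 0ℚ < x → 0ℚ < inv x
inv-pos {mkℚ (+ zero) _ _} 0<x = ⊥-elim (ℕ.NonZero.nonZero (ℚ.>-nonZero 0<x))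
inv-pos {x@(mkℚ (+ suc _) _ _)} _ = ℚP.positive⁻¹ (1/ x) {{ℚP.1/pos⇒pos x}}
inv-pos {mkℚ -[1+ _ ] _ _} 0<x = ⊥-elim (ℤ.Positive.pos (ℚ.positive 0<x))

*-pos : ∀ {x y} → 0ℚ < x → 0ℚ < y → 0ℚ < x * y
*-pos {x} {y} 0<x 0<y =
  ℚP.positive⁻¹ (x * y) {{ℚP.pos*pos⇒pos x {{ℚ.positive 0<x}} y {{ℚ.positive 0<y}}}}

pos⇒≢0 : ∀ {x} → 0ℚ < x → x ≢ 0ℚ
pos⇒≢0 0<x x≡0 = ℚP.<⇒≢ 0<x (sym x≡0)

<1⇒0<1- : ∀ {x} → x < 1ℚ → 0ℚ < 1ℚ - x
<1⇒0<1- {x} x<1 = ℚP.<-respˡ-≡ (ℚP.+-inverseʳ x) (ℚP.+-monoˡ-< (- x) x<1)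

^-distribˡ-+-* : ∀ x m n → x ^ (m ℕ.+ n) ≡ x ^ m * x ^ n
^-distribˡ-+-* x zero n = sym (ℚP.*-identityˡ (x ^ n))
^-distribˡ-+-* x (suc m) n =
  trans (cong (x *_) (^-distribˡ-+-* x m n)) (sym (ℚP.*-assoc x (x ^ m) (x ^ n)))

Σ1-cong : ∀ n {f g : ℕ → ℚ} → (∀ k → 1 ℕ.≤ k → k ℕ.≤ n → f k ≡ g k) → Σ1 n f ≡ Σ1 n g
Σ1-cong zero    f≗g = refl
Σ1-cong (suc n) f≗g =
  cong₂ _+_ (Σ1-cong n (λ k 1≤k k≤n → f≗g k 1≤k (ℕP.m≤n⇒m≤1+n k≤n))) (f≗g (suc n) (s≤s z≤n) ℕP.≤-refl)

Σ1-vanish : ∀ n {f : ℕ → ℚ} → (∀ k → 1 ℕ.≤ k → k ℕ.≤ n → f k ≡ 0ℚ) → Σ1 n f ≡ 0ℚ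
Σ1-vanish n {f} f≗0 = trans (Σ1-cong n f≗0) (zeros n)
  where zeros : ∀ n → Σ1 n (λ _ → 0ℚ) ≡ 0ℚ
        zeros zero    = refl
        zeros (suc n) = cong (_+ 0ℚ) (zeros n)

Σ1-distrib-+ : ∀ n (f g : ℕ → ℚ) → Σ1 n (λ k → f k + g k) ≡ Σ1 n f + Σ1 n g
Σ1-distrib-+ zero    f g = refl
Σ1-distrib-+ (suc n) f g =
  trans (cong (_+ (f (suc n) + g (suc n))) (Σ1-distrib-+ n f g))
        (+-interchange (Σ1 n f) (Σ1 n g) (f (suc n)) (g (suc n)))

Σ1-*ˡ : ∀ n c (f : ℕ → ℚ) → Σ1 n (λ k → c * f k) ≡ c * Σ1 n f
Σ1-*ˡ zero    c f = sym (ℚP.*-zeroʳ c)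
Σ1-*ˡ (suc n) c f =
  trans (cong (_+ c * f (suc n)) (Σ1-*ˡ n c f)) (sym (ℚP.*-distribˡ-+ c (Σ1 n f) (f (suc n))))

Σ1-*ʳ : ∀ n c (f : ℕ → ℚ) → Σ1 n (λ k → f k * c) ≡ Σ1 n f * c
Σ1-*ʳ n c f =
  trans (Σ1-cong n (λ k _ _ → ℚP.*-comm (f k) c)) (trans (Σ1-*ˡ n c f) (ℚP.*-comm c (Σ1 n f)))

Σ1-drop-last : ∀ n (f : ℕ → ℚ) → f (suc n) ≡ 0ℚ → Σ1 (suc n) f ≡ Σ1 n f
Σ1-drop-last n f f[1+n]≡0 = trans (cong (_+_ (Σ1 n f)) f[1+n]≡0) (ℚP.+-identityʳ (Σ1 n f))

Σ1-extend : ∀ n d (f : ℕ → ℚ) → (∀ k → n ℕ.< k → f k ≡ 0ℚ) → Σ1 (d ℕ.+ n) f ≡ Σ1 n f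
Σ1-extend n zero    f f≗0 = refl
Σ1-extend n (suc d) f f≗0 =
  trans (Σ1-drop-last (d ℕ.+ n) f (f≗0 (suc (d ℕ.+ n)) (s≤s (ℕP.m≤n+m n d)))) (Σ1-extend n d f f≗0)

ΣBools-cong : ∀ m {f g : Vec Bool m → ℚ} → (∀ v → f v ≡ g v) → ΣBools m f ≡ ΣBools m g
ΣBools-cong zero    f≗g = f≗g []
ΣBools-cong (suc m) f≗g = cong₂ _+_ (ΣBools-cong m (λ v → f≗g (true ∷ v))) (ΣBools-cong m (λ v → f≗g (false ∷ v)))

ΣBools-distrib-+ : ∀ m (f g : Vec Bool m → ℚ) → ΣBools m (λ v → f v + g v) ≡ ΣBools m f + ΣBools m g
ΣBools-distrib-+ zero    f g = refl
ΣBools-distrib-+ (suc m) f g = trans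
  (cong₂ _+_ (ΣBools-distrib-+ m (λ v → f (true ∷ v)) (λ v → g (true ∷ v)))
             (ΣBools-distrib-+ m (λ v → f (false ∷ v)) (λ v → g (false ∷ v))))
  (+-interchange (ΣBools m (λ v → f (true ∷ v))) (ΣBools m (λ v → g (true ∷ v)))
                 (ΣBools m (λ v → f (false ∷ v))) (ΣBools m (λ v → g (false ∷ v))))

Σ> : ℕ → ℕ → (ℕ → ℚ) → ℚ
Σ> k n g = Σ1 n (λ j → if k ℕ.<ᵇ j then g j else 0ℚ)

<ᵇ-true : ∀ {j k} → k ℕ.< j → (k ℕ.<ᵇ j) ≡ true
<ᵇ-true {j} {k} k<j with k ℕ.<ᵇ j | ℕP.<⇒<ᵇ k<j
... | true | _ = refl

<ᵇ-false : ∀ {j k} → j ℕ.≤ k → (k ℕ.<ᵇ j) ≡ false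
<ᵇ-false {j} {k} j≤k with k ℕ.<ᵇ j in eq
... | true  = ⊥-elim (ℕP.<⇒≱ (ℕP.<ᵇ⇒< k j (subst T (sym eq) tt)) j≤k)
... | false = refl

Σ>-cong : ∀ k n {f g : ℕ → ℚ} → (∀ j → 1 ℕ.≤ j → j ℕ.≤ n → f j ≡ g j) → Σ> k n f ≡ Σ> k n g
Σ>-cong k n f≗g = Σ1-cong n (λ j 1≤j j≤n → cong (if k ℕ.<ᵇ j then_else 0ℚ) (f≗g j 1≤j j≤n))

Σ>-vanish : ∀ k n (g : ℕ → ℚ) → n ℕ.≤ k → Σ> k n g ≡ 0ℚ
Σ>-vanish k n g n≤k =
  Σ1-vanish n (λ j _ j≤n → cong (if_then g j else 0ℚ) (<ᵇ-false (ℕP.≤-trans j≤n n≤k)))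

Σ>-drop-last : ∀ k n (g : ℕ → ℚ) → g (suc n) ≡ 0ℚ → Σ> k (suc n) g ≡ Σ> k n g
Σ>-drop-last k n g g[1+n]≡0 = Σ1-drop-last n _ (bracket-0 (k ℕ.<ᵇ suc n) g[1+n]≡0)
  where bracket-0 : ∀ c {x} → x ≡ 0ℚ → (if c then x else 0ℚ) ≡ 0ℚ
        bracket-0 true  x≡0 = x≡0
        bracket-0 false _   = refl

Σ>-linear : ∀ k n c (f g : ℕ → ℚ) → Σ> k n (λ j → f j + c * g j) ≡ Σ> k n f + c * Σ> k n g
Σ>-linear k n c f g = begin
  Σ> k n (λ j → f j + c * g j)
    ≡⟨ Σ1-cong n (λ j _ _ → bracket-linear (k ℕ.<ᵇ j)) ⟩
  Σ1 n (λ j → (if k ℕ.<ᵇ j then f j else 0ℚ) + c * (if k ℕ.<ᵇ j then g j else 0ℚ))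
    ≡⟨ Σ1-distrib-+ n _ _ ⟩
  Σ> k n f + Σ1 n (λ j → c * (if k ℕ.<ᵇ j then g j else 0ℚ))
    ≡⟨ cong (λ x → Σ> k n f + x) (Σ1-*ˡ n c _) ⟩
  Σ> k n f + c * Σ> k n g ∎
  where
  bracket-linear : ∀ b {x y} → (if b then x + c * y else 0ℚ) ≡ (if b then x else 0ℚ) + c * (if b then y else 0ℚ)
  bracket-linear true  = refl
  bracket-linear false = sym (trans (cong (_+_ 0ℚ) (ℚP.*-zeroʳ c)) (ℚP.+-identityʳ 0ℚ))

Σ>-telescope : ∀ k M (f D : ℕ → ℚ) → k ℕ.≤ M → (∀ j → k ℕ.< j → j ℕ.≤ M → f j ≡ D (j ℕ.∸ 1) - D j)
             → Σ> k M f ≡ D k - D M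
Σ>-telescope k M f D k≤M f≡ΔD with ℕP.m≤n⇒m<n∨m≡n k≤M
... | inj₂ refl = trans (Σ>-vanish M M f ℕP.≤-refl) (sym (ℚP.+-inverseʳ (D M)))
Σ>-telescope k (suc M) f D _ f≡ΔD | inj₁ (s≤s k≤M) = begin
  Σ> k M f + (if k ℕ.<ᵇ suc M then f (suc M) else 0ℚ)
    ≡⟨ cong₂ _+_ (Σ>-telescope k M f D k≤M (λ j k<j j≤M → f≡ΔD j k<j (ℕP.m≤n⇒m≤1+n j≤M)))
                 (cong (if_then f (suc M) else 0ℚ) (<ᵇ-true (s≤s k≤M))) ⟩
  (D k - D M) + f (suc M)
    ≡⟨ cong (_+_ (D k - D M)) (f≡ΔD (suc M) (s≤s k≤M) ℕP.≤-refl) ⟩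
  (D k - D M) + (D M - D (suc M))
    ≡⟨ chain (D k) (D M) (D (suc M)) ⟩
  D k - D (suc M) ∎
  where
  chain : ∀ x y z → (x - y) + (y - z) ≡ x - z
  chain = solve 3 (λ x y z → (x :- y) :+ (y :- z) := x :- z) refl

Σ1-triangle : ∀ n (g h : ℕ → ℚ) → Σ1 n (λ j → g j * Σ1 (j ℕ.∸ 1) h) ≡ Σ1 n (λ k → h k * Σ> k n g)
Σ1-triangle zero    g h = refl
Σ1-triangle (suc n) g h = begin
  Σ1 n (λ j → g j * Σ1 (j ℕ.∸ 1) h) + g (suc n) * Σ1 n h
    ≡⟨ cong₂ _+_ (Σ1-triangle n g h) (trans (ℚP.*-comm (g (suc n)) (Σ1 n h)) (sym (Σ1-*ʳ n (g (suc n)) h))) ⟩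
  Σ1 n (λ k → h k * Σ> k n g) + Σ1 n (λ k → h k * g (suc n))
    ≡⟨ sym (Σ1-distrib-+ n _ _) ⟩
  Σ1 n (λ k → h k * Σ> k n g + h k * g (suc n))
    ≡⟨ Σ1-cong n (λ k _ k≤n → trans (sym (ℚP.*-distribˡ-+ (h k) _ _))
         (cong (λ b → h k * (Σ> k n g + (if b then g (suc n) else 0ℚ))) (sym (<ᵇ-true (s≤s k≤n))))) ⟩
  Σ1 n (λ k → h k * Σ> k (suc n) g)
    ≡⟨ sym (Σ1-drop-last n _ (trans (cong (h (suc n) *_) (Σ>-vanish (suc n) (suc n) g ℕP.≤-refl))
                                     (ℚP.*-zeroʳ (h (suc n))))) ⟩
  Σ1 (suc n) (λ k → h k * Σ> k (suc n) g) ∎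

glue-+head : ∀ {m} (ss : Vec ℕ m) (v : Vec Bool m) x₁ x₂ y₁ y₂ →
  Σ[ a ∈ ℕ ] Σ[ b ∈ ℕ ] Σ[ rest ∈ List (ℤ × ℤ) ]
    y₂ ℕ.≤ b × glue (+ y₁ , + y₂) (ptVec ss) v ≡ (+ a , + b) ∷ rest
            × glue (+ (x₁ ℕ.+ y₁) , + (x₂ ℕ.+ y₂)) (ptVec ss) v ≡ (+ (x₁ ℕ.+ a) , + (x₂ ℕ.+ b)) ∷ rest
glue-+head []       []           x₁ x₂ y₁ y₂ = y₁ , y₂ , [] , ℕP.≤-refl , refl , refl
glue-+head (s ∷ ss) (false ∷ v) x₁ x₂ y₁ y₂ = y₁ , y₂ , glue (pt s) (ptVec ss) v , ℕP.≤-refl , refl , refl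
glue-+head (s ∷ ss) (true ∷ v)  x₁ x₂ y₁ y₂
  with glue-+head ss v x₁ x₂ (y₁ ℕ.+ (2 ℕ.* s ℕ.+ 1)) (y₂ ℕ.+ (s ℕ.+ 1))
... | a , b , rest , y₂+s+1≤b , glue-y , glue-x+y =
  a , b , rest , ℕP.≤-trans (ℕP.m≤m+n y₂ (s ℕ.+ 1)) y₂+s+1≤b , glue-y ,
  trans (cong₂ (λ A B → glue (+ A , + B) (ptVec ss) v) (ℕP.+-assoc x₁ y₁ (2 ℕ.* s ℕ.+ 1)) (ℕP.+-assoc x₂ y₂ (s ℕ.+ 1)))
        glue-x+y

-- Cleared of denominators, this is (1 - xy)² = (1 - x)(1 - xy²) + x(1 - y)², for x = q^{n+1-j} and
-- y = q^j; i₁ and i₂ play the roles of 1/[j] and 1/[n+1] (with [m] = (1 - q^m) u), r and s those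
-- of 1/(1 - x) and 1/(1 - xy²).
ρ-step-identity : ∀ K x y r s u i₁ i₂ → r * (1ℚ - x) ≡ 1ℚ → s * (1ℚ - x * y * y) ≡ 1ℚ
  → i₁ * ((1ℚ - y) * u) ≡ 1ℚ → i₂ * ((1ℚ - x * y) * u) ≡ 1ℚ
  → (K * ((1ℚ - x * y) * (1ℚ - x * y)) * r * s) * (y * (i₁ * i₁))
    ≡ K * (y * (i₁ * i₁)) + (x * y) * (i₂ * i₂) * (K * ((1ℚ - x * y) * (1ℚ - x * y)) * r * s)
ρ-step-identity K x y r s u i₁ i₂ r≡ s≡ i₁≡ i₂≡ = begin
  (K * ((1ℚ - x * y) * (1ℚ - x * y)) * r * s) * (y * (i₁ * i₁))
    ≡⟨ expand K x y r s i₁ ⟩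
  K * y * (i₁ * i₁) * (r * (1ℚ - x)) * (s * (1ℚ - x * y * y)) + X
    ≡⟨ cong₂ (λ A B → K * y * (i₁ * i₁) * A * B + X) r≡ s≡ ⟩
  K * y * (i₁ * i₁) * 1ℚ * 1ℚ + X
    ≡⟨ cong (_+_ (K * y * (i₁ * i₁) * 1ℚ * 1ℚ)) X≡Z ⟩
  K * y * (i₁ * i₁) * 1ℚ * 1ℚ + Z
    ≡⟨ collect K x y r s i₁ i₂ ⟩
  K * (y * (i₁ * i₁)) + (x * y) * (i₂ * i₂) * (K * ((1ℚ - x * y) * (1ℚ - x * y)) * r * s) ∎
  where
  X Z : ℚ
  X = x * y * K * r * s * ((1ℚ - y) * (1ℚ - y)) * (i₁ * i₁)
  Z = x * y * K * r * s * (i₂ * i₂) * ((1ℚ - x * y) * (1ℚ - x * y))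
  expand : ∀ K x y r s i₁ → (K * ((1ℚ - x * y) * (1ℚ - x * y)) * r * s) * (y * (i₁ * i₁))
    ≡ K * y * (i₁ * i₁) * (r * (1ℚ - x)) * (s * (1ℚ - x * y * y))
      + x * y * K * r * s * ((1ℚ - y) * (1ℚ - y)) * (i₁ * i₁)
  expand = solve 6 (λ K x y r s i₁ → (K :* ((con 1ℚ :- x :* y) :* (con 1ℚ :- x :* y)) :* r :* s) :* (y :* (i₁ :* i₁))
    := K :* y :* (i₁ :* i₁) :* (r :* (con 1ℚ :- x)) :* (s :* (con 1ℚ :- x :* y :* y))
       :+ x :* y :* K :* r :* s :* ((con 1ℚ :- y) :* (con 1ℚ :- y)) :* (i₁ :* i₁)) refl
  collect : ∀ K x y r s i₁ i₂
    → K * y * (i₁ * i₁) * 1ℚ * 1ℚ + x * y * K * r * s * (i₂ * i₂) * ((1ℚ - x * y) * (1ℚ - x * y))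
    ≡ K * (y * (i₁ * i₁)) + (x * y) * (i₂ * i₂) * (K * ((1ℚ - x * y) * (1ℚ - x * y)) * r * s)
  collect = solve 7 (λ K x y r s i₁ i₂ →
       K :* y :* (i₁ :* i₁) :* con 1ℚ :* con 1ℚ
         :+ x :* y :* K :* r :* s :* (i₂ :* i₂) :* ((con 1ℚ :- x :* y) :* (con 1ℚ :- x :* y))
    := K :* (y :* (i₁ :* i₁)) :+ (x :* y) :* (i₂ :* i₂) :* (K :* ((con 1ℚ :- x :* y) :* (con 1ℚ :- x :* y)) :* r :* s)) refl
  trade : ∀ x y K r s i₁ i₂ u
    → x * y * K * r * s * ((1ℚ - y) * (1ℚ - y)) * (i₁ * i₁) * ((i₂ * ((1ℚ - x * y) * u)) * (i₂ * ((1ℚ - x * y) * u)))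
    ≡ x * y * K * r * s * (i₂ * i₂) * ((1ℚ - x * y) * (1ℚ - x * y)) * ((i₁ * ((1ℚ - y) * u)) * (i₁ * ((1ℚ - y) * u)))
  trade = solve 8 (λ x y K r s i₁ i₂ u →
         x :* y :* K :* r :* s :* ((con 1ℚ :- y) :* (con 1ℚ :- y)) :* (i₁ :* i₁)
           :* ((i₂ :* ((con 1ℚ :- x :* y) :* u)) :* (i₂ :* ((con 1ℚ :- x :* y) :* u)))
      := x :* y :* K :* r :* s :* (i₂ :* i₂) :* ((con 1ℚ :- x :* y) :* (con 1ℚ :- x :* y))
           :* ((i₁ :* ((con 1ℚ :- y) :* u)) :* (i₁ :* ((con 1ℚ :- y) :* u)))) refl
  -- i₂ (1 - xy) and i₁ (1 - y) are both the inverse of u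
  X≡Z : X ≡ Z
  X≡Z = begin
    X                                                             ≡⟨ sym (ℚP.*-identityʳ X) ⟩
    X * (1ℚ * 1ℚ)                                                 ≡⟨ cong (λ c → X * (c * c)) (sym i₂≡) ⟩
    X * ((i₂ * ((1ℚ - x * y) * u)) * (i₂ * ((1ℚ - x * y) * u)))   ≡⟨ trade x y K r s i₁ i₂ u ⟩
    Z * ((i₁ * ((1ℚ - y) * u)) * (i₁ * ((1ℚ - y) * u)))           ≡⟨ cong (λ c → Z * (c * c)) i₁≡ ⟩
    Z * (1ℚ * 1ℚ)                                                 ≡⟨ ℚP.*-identityʳ Z ⟩
    Z                                                             ∎

-- The summand identity behind ρV-telescopes, with X = q^i, Z = q^{d+1}, W = q^{i²}, u = 1/(1 - q),
-- r = ρ(N,i), r′ = ρ(N,i+1) and N = i + d + 1.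
ρV-telescoping-identity : ∀ q X Z W u r r′ → r * (1ℚ - Z) ≡ r′ * (1ℚ - X * Z * (q * X))
  → r′ * ((X * W) * (1ℚ + q * X) * ((1ℚ - q * X) * u))
    ≡ W * r * ((1ℚ - X * Z) * u - (1ℚ - X) * u) - (q * X * (X * W)) * r′ * ((1ℚ - X * Z) * u - (1ℚ - q * X) * u)
ρV-telescoping-identity q X Z W u r r′ r≡r′ = begin
  r′ * ((X * W) * (1ℚ + q * X) * ((1ℚ - q * X) * u))
    ≡⟨ split q X Z W u r′ ⟩
  W * u * X * (r′ * (1ℚ - X * Z * (q * X))) - q * X * X * W * r′ * u * (q * X - X * Z)
    ≡⟨ cong (λ A → W * u * X * A - q * X * X * W * r′ * u * (q * X - X * Z)) (sym r≡r′) ⟩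
  W * u * X * (r * (1ℚ - Z)) - q * X * X * W * r′ * u * (q * X - X * Z)
    ≡⟨ merge q X Z W u r r′ ⟩
  W * r * ((1ℚ - X * Z) * u - (1ℚ - X) * u) - (q * X * (X * W)) * r′ * ((1ℚ - X * Z) * u - (1ℚ - q * X) * u) ∎
  where
  split : ∀ q X Z W u r′ → r′ * ((X * W) * (1ℚ + q * X) * ((1ℚ - q * X) * u))
    ≡ W * u * X * (r′ * (1ℚ - X * Z * (q * X))) - q * X * X * W * r′ * u * (q * X - X * Z)
  split = solve 6 (λ q X Z W u r′ → r′ :* ((X :* W) :* (con 1ℚ :+ q :* X) :* ((con 1ℚ :- q :* X) :* u))
    := W :* u :* X :* (r′ :* (con 1ℚ :- X :* Z :* (q :* X))) :- q :* X :* X :* W :* r′ :* u :* (q :* X :- X :* Z)) refl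
  merge : ∀ q X Z W u r r′ → W * u * X * (r * (1ℚ - Z)) - q * X * X * W * r′ * u * (q * X - X * Z)
    ≡ W * r * ((1ℚ - X * Z) * u - (1ℚ - X) * u) - (q * X * (X * W)) * r′ * ((1ℚ - X * Z) * u - (1ℚ - q * X) * u)
  merge = solve 7 (λ q X Z W u r r′ → W :* u :* X :* (r :* (con 1ℚ :- Z)) :- q :* X :* X :* W :* r′ :* u :* (q :* X :- X :* Z)
    := W :* r :* ((con 1ℚ :- X :* Z) :* u :- (con 1ℚ :- X) :* u)
       :- (q :* X :* (X :* W)) :* r′ :* ((con 1ℚ :- X :* Z) :* u :- (con 1ℚ :- q :* X) :* u)) refl

module _ (q : ℚ) where

  w₂ w₁ : ℕ → ℚ
  w₂ l = q ^ l * inv (qint q l ^ℤ (+ 2))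
  w₁ l = q ^ l * inv (qint q l ^ℤ (+ 1))

  w₂≡ : ∀ l → w₂ l ≡ q ^ l * (inv (qint q l) * inv (qint q l))
  w₂≡ l = cong (q ^ l *_) (trans (inv-distrib-* Q (Q * 1ℚ))
                                 (cong (inv Q *_) (trans (inv-distrib-* Q 1ℚ) (ℚP.*-identityʳ (inv Q)))))
    where Q : ℚ
          Q = qint q l

  w₁≡ : ∀ l → w₁ l ≡ q ^ l * inv (qint q l)
  w₁≡ l = cong (q ^ l *_) (trans (inv-distrib-* (qint q l) 1ℚ) (ℚP.*-identityʳ _))

  nested : ℕ → (ℕ → ℚ) → ℕ → ℚ
  nested zero    f n = Σ1 n (λ l → w₁ l * f l)
  nested (suc s) f n = Σ1 n (λ l → w₂ l * nested s f l)

  Hstar≡nested : ∀ s n rest → Hstar q n (replicate s (+ 2) ++ (+ 1 ∷ rest)) ≡ nested s (λ l → Hstar q l rest) n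
  Hstar≡nested zero    n rest = refl
  Hstar≡nested (suc s) n rest = Σ1-cong n (λ k _ _ → cong (w₂ k *_) (Hstar≡nested s k rest))

  nested-cong : ∀ s n {f g : ℕ → ℚ} → (∀ l → l ℕ.≤ n → f l ≡ g l) → nested s f n ≡ nested s g n
  nested-cong zero    n f≗g = Σ1-cong n (λ l _ l≤n → cong (w₁ l *_) (f≗g l l≤n))
  nested-cong (suc s) n f≗g =
    Σ1-cong n (λ l _ l≤n → cong (w₂ l *_) (nested-cong s l (λ i i≤l → f≗g i (ℕP.≤-trans i≤l l≤n))))

  nested-zero : ∀ s n → nested s (λ _ → 0ℚ) n ≡ 0ℚ
  nested-zero zero    n = Σ1-vanish n (λ l _ _ → ℚP.*-zeroʳ (w₁ l))
  nested-zero (suc s) n = Σ1-vanish n (λ l _ _ → trans (cong (w₂ l *_) (nested-zero s l)) (ℚP.*-zeroʳ (w₂ l)))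

  nested-+ : ∀ s n (f g : ℕ → ℚ) → nested s (λ l → f l + g l) n ≡ nested s f n + nested s g n
  nested-+ zero    n f g =
    trans (Σ1-cong n (λ l _ _ → ℚP.*-distribˡ-+ (w₁ l) (f l) (g l))) (Σ1-distrib-+ n _ _)
  nested-+ (suc s) n f g =
    trans (Σ1-cong n (λ l _ _ → trans (cong (w₂ l *_) (nested-+ s l f g))
                                      (ℚP.*-distribˡ-+ (w₂ l) (nested s f l) (nested s g l))))
          (Σ1-distrib-+ n _ _)

  nested-*ʳ : ∀ s n c (f : ℕ → ℚ) → nested s (λ l → f l * c) n ≡ nested s f n * c
  nested-*ʳ zero    n c f = trans (Σ1-cong n (λ l _ _ → sym (ℚP.*-assoc (w₁ l) (f l) c))) (Σ1-*ʳ n c _)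
  nested-*ʳ (suc s) n c f =
    trans (Σ1-cong n (λ l _ _ → trans (cong (w₂ l *_) (nested-*ʳ s l c f)) (sym (ℚP.*-assoc (w₂ l) (nested s f l) c))))
          (Σ1-*ʳ n c _)

  nested-Σ1 : ∀ s n N (F : ℕ → ℕ → ℚ) → nested s (λ l → Σ1 N (F l)) n ≡ Σ1 N (λ k → nested s (λ l → F l k) n)
  nested-Σ1 s n zero    F = nested-zero s n
  nested-Σ1 s n (suc N) F =
    trans (nested-+ s n (λ l → Σ1 N (F l)) (λ l → F l (suc N))) (cong (_+ nested s (λ l → F l (suc N)) n) (nested-Σ1 s n N F))

  nested-ΣBools : ∀ s n m (F : Vec Bool m → ℕ → ℚ) →
    nested s (λ l → ΣBools m (λ v → F v l)) n ≡ ΣBools m (λ v → nested s (F v) n)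
  nested-ΣBools s n zero    F = refl
  nested-ΣBools s n (suc m) F =
    trans (nested-+ s n _ _) (cong₂ _+_ (nested-ΣBools s n m (λ v → F (true ∷ v))) (nested-ΣBools s n m (λ v → F (false ∷ v))))

  ρ : ℕ → ℕ → ℚ
  ρ n k = qbinom q n k * inv (qbinom q (n ℕ.+ k) k)

  qbinom-≤ : ∀ {n k} → k ℕ.≤ n → qbinom q n k ≡ qpoch q n * inv (qpoch q k * qpoch q (n ℕ.∸ k))
  qbinom-≤ {n} {k} k≤n with k ℕ.≤ᵇ n | ℕP.≤⇒≤ᵇ k≤n
  ... | true | _ = refl

  qbinom-> : ∀ {n k} → n ℕ.< k → qbinom q n k ≡ 0ℚ
  qbinom-> {n} {k} n<k with k ℕ.≤ᵇ n in eq
  ... | true  = ⊥-elim (ℕP.<⇒≱ n<k (ℕP.≤ᵇ⇒≤ k n (subst T (sym eq) tt)))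
  ... | false = refl

  ρ-vanish : ∀ {n k} → n ℕ.< k → ρ n k ≡ 0ℚ
  ρ-vanish {n} {k} n<k = trans (cong (_* inv (qbinom q (n ℕ.+ k) k)) (qbinom-> n<k)) (ℚP.*-zeroˡ (inv (qbinom q (n ℕ.+ k) k)))

  plusWeight commaWeight : ℕ → ℕ → ℚ
  plusWeight  s k = q ^ (k ℕ.* k) * (q ^ (suc s ℕ.* k) * inv (qint q k ^ (2 ℕ.* s ℕ.+ 1)))
  commaWeight s j = q ^ (j ℕ.* j) * (q ^ (s ℕ.* j) * (1ℚ + q ^ j) * inv (qint q j ^ (2 ℕ.* s ℕ.+ 1)))

  w₂-absorb : ∀ k m X → q ^ k * X * inv (qint q k ^ (2 ℕ.+ m)) ≡ w₂ k * (X * inv (qint q k ^ m))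
  w₂-absorb k m X = begin
    q ^ k * X * inv (Q * (Q * Q ^ m))
      ≡⟨ cong (q ^ k * X *_) (trans (inv-distrib-* Q (Q * Q ^ m)) (cong (inv Q *_) (inv-distrib-* Q (Q ^ m)))) ⟩
    q ^ k * X * (inv Q * (inv Q * inv (Q ^ m)))
      ≡⟨ regroup (q ^ k) X (inv Q) (inv (Q ^ m)) ⟩
    q ^ k * (inv Q * inv Q) * (X * inv (Q ^ m))
      ≡⟨ cong (_* (X * inv (Q ^ m))) (sym (w₂≡ k)) ⟩
    w₂ k * (X * inv (Q ^ m)) ∎
    where
    Q : ℚ
    Q = qint q k
    regroup : ∀ a x i j → a * x * (i * (i * j)) ≡ a * (i * i) * (x * j)
    regroup = solve 4 (λ a x i j → a :* x :* (i :* (i :* j)) := a :* (i :* i) :* (x :* j)) refl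

  private
    2[1+s]+1≡2+[2s+1] : ∀ s → 2 ℕ.* suc s ℕ.+ 1 ≡ 2 ℕ.+ (2 ℕ.* s ℕ.+ 1)
    2[1+s]+1≡2+[2s+1] s = trans (cong (ℕ._+ 1) (ℕP.*-suc 2 s)) (ℕP.+-assoc 2 (2 ℕ.* s) 1)

  plusWeight-suc : ∀ s k → plusWeight (suc s) k ≡ w₂ k * plusWeight s k
  plusWeight-suc s k = begin
    q ^ (k ℕ.* k) * (q ^ (k ℕ.+ suc s ℕ.* k) * inv (qint q k ^ (2 ℕ.* suc s ℕ.+ 1)))
      ≡⟨ cong₂ (λ A m → q ^ (k ℕ.* k) * (A * inv (qint q k ^ m))) (^-distribˡ-+-* q k (suc s ℕ.* k)) (2[1+s]+1≡2+[2s+1] s) ⟩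
    q ^ (k ℕ.* k) * (q ^ k * q ^ (suc s ℕ.* k) * inv (qint q k ^ (2 ℕ.+ (2 ℕ.* s ℕ.+ 1))))
      ≡⟨ cong (q ^ (k ℕ.* k) *_) (w₂-absorb k (2 ℕ.* s ℕ.+ 1) (q ^ (suc s ℕ.* k))) ⟩
    q ^ (k ℕ.* k) * (w₂ k * (q ^ (suc s ℕ.* k) * inv (qint q k ^ (2 ℕ.* s ℕ.+ 1))))
      ≡⟨ *-left-comm (q ^ (k ℕ.* k)) (w₂ k) _ ⟩
    w₂ k * plusWeight s k ∎

  commaWeight-suc : ∀ s j → commaWeight (suc s) j ≡ w₂ j * commaWeight s j
  commaWeight-suc s j = begin
    q ^ (j ℕ.* j) * (q ^ (j ℕ.+ s ℕ.* j) * (1ℚ + q ^ j) * inv (qint q j ^ (2 ℕ.* suc s ℕ.+ 1)))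
      ≡⟨ cong₂ (λ A m → q ^ (j ℕ.* j) * (A * (1ℚ + q ^ j) * inv (qint q j ^ m)))
               (^-distribˡ-+-* q j (s ℕ.* j)) (2[1+s]+1≡2+[2s+1] s) ⟩
    q ^ (j ℕ.* j) * (q ^ j * q ^ (s ℕ.* j) * (1ℚ + q ^ j) * inv (qint q j ^ (2 ℕ.+ (2 ℕ.* s ℕ.+ 1))))
      ≡⟨ cong (λ A → q ^ (j ℕ.* j) * (A * inv (qint q j ^ (2 ℕ.+ (2 ℕ.* s ℕ.+ 1)))))
              (ℚP.*-assoc (q ^ j) (q ^ (s ℕ.* j)) (1ℚ + q ^ j)) ⟩
    q ^ (j ℕ.* j) * (q ^ j * (q ^ (s ℕ.* j) * (1ℚ + q ^ j)) * inv (qint q j ^ (2 ℕ.+ (2 ℕ.* s ℕ.+ 1))))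
      ≡⟨ cong (q ^ (j ℕ.* j) *_) (w₂-absorb j (2 ℕ.* s ℕ.+ 1) (q ^ (s ℕ.* j) * (1ℚ + q ^ j))) ⟩
    q ^ (j ℕ.* j) * (w₂ j * (q ^ (s ℕ.* j) * (1ℚ + q ^ j) * inv (qint q j ^ (2 ℕ.* s ℕ.+ 1))))
      ≡⟨ *-left-comm (q ^ (j ℕ.* j)) (w₂ j) _ ⟩
    w₂ j * commaWeight s j ∎

  qint-0 : qint q 0 ≡ 0ℚ
  qint-0 = ℚP.*-zeroˡ (inv (1ℚ - q))

  -- True only because [0] = 0 and inv 0 = 0; it lets the case k = 0 of nested-ρ, where ρ l 0 = 1,
  -- give the base case m = 0 of the theorem.
  plusWeight-0 : ∀ s → plusWeight s 0 ≡ 0ℚ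
  plusWeight-0 s = begin
    q ^ 0 * (q ^ (suc s ℕ.* 0) * inv (qint q 0 ^ (2 ℕ.* s ℕ.+ 1)))
      ≡⟨ cong (λ x → q ^ 0 * (q ^ (suc s ℕ.* 0) * inv x)) [0]^[2s+1]≡0 ⟩
    q ^ 0 * (q ^ (suc s ℕ.* 0) * 0ℚ)
      ≡⟨ trans (cong (q ^ 0 *_) (ℚP.*-zeroʳ (q ^ (suc s ℕ.* 0)))) (ℚP.*-zeroʳ (q ^ 0)) ⟩
    0ℚ ∎
    where
    [0]^[2s+1]≡0 : qint q 0 ^ (2 ℕ.* s ℕ.+ 1) ≡ 0ℚ
    [0]^[2s+1]≡0 = trans (cong (qint q 0 ^_) (ℕP.+-comm (2 ℕ.* s) 1))
                         (trans (cong (_* (qint q 0 ^ (2 ℕ.* s))) qint-0) (ℚP.*-zeroˡ (qint q 0 ^ (2 ℕ.* s))))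

  private
    [1+m-1]*k : ∀ m k → (+ suc m ℤ.- + 1) ℤ.* (+ k) ≡ + (m ℕ.* k)
    [1+m-1]*k m k = ℤP.+◃n≡+n (m ℕ.* k)

  term-comma : ∀ s j → q ^ (j ℕ.* j) * term q (+ (2 ℕ.* s ℕ.+ 1)) (+ (s ℕ.+ 1)) j ≡ commaWeight s j
  term-comma s j = trans
    (cong (λ t → q ^ (j ℕ.* j) * (q ^ℤ ((+ t ℤ.- + 1) ℤ.* + j) * (1ℚ + q ^ j) * inv (qint q j ^ (2 ℕ.* s ℕ.+ 1))))
          (ℕP.+-comm s 1))
    (cong (λ e → q ^ (j ℕ.* j) * (q ^ℤ e * (1ℚ + q ^ j) * inv (qint q j ^ (2 ℕ.* s ℕ.+ 1)))) ([1+m-1]*k s j))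

  term-plus : ∀ s a b k → 1 ℕ.≤ b →
    q ^ (k ℕ.* k) * term q (+ (2 ℕ.* s ℕ.+ 1 ℕ.+ a)) (+ (s ℕ.+ 1 ℕ.+ b)) k ≡ term q (+ a) (+ b) k * plusWeight s k
  term-plus s a (suc b) k _ = begin
    q ^ (k ℕ.* k) * (q ^ℤ ((+ (s ℕ.+ 1 ℕ.+ suc b) ℤ.- + 1) ℤ.* + k) * (1ℚ + q ^ k) * inv (Q ^ (2 ℕ.* s ℕ.+ 1 ℕ.+ a)))
      ≡⟨ cong (λ t → q ^ (k ℕ.* k) * (q ^ℤ ((+ t ℤ.- + 1) ℤ.* + k) * (1ℚ + q ^ k) * inv (Q ^ (2 ℕ.* s ℕ.+ 1 ℕ.+ a))))
              s+1+[1+b]≡1+[b+[1+s]] ⟩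
    q ^ (k ℕ.* k) * (q ^ℤ ((+ suc (b ℕ.+ suc s) ℤ.- + 1) ℤ.* + k) * (1ℚ + q ^ k) * inv (Q ^ (2 ℕ.* s ℕ.+ 1 ℕ.+ a)))
      ≡⟨ cong₂ (λ e X → q ^ (k ℕ.* k) * (q ^ℤ e * (1ℚ + q ^ k) * inv X))
               ([1+m-1]*k (b ℕ.+ suc s) k) (^-distribˡ-+-* Q (2 ℕ.* s ℕ.+ 1) a) ⟩
    q ^ (k ℕ.* k) * (q ^ ((b ℕ.+ suc s) ℕ.* k) * (1ℚ + q ^ k) * inv (Q ^ (2 ℕ.* s ℕ.+ 1) * Q ^ a))
      ≡⟨ cong₂ (λ e X → q ^ (k ℕ.* k) * (q ^ e * (1ℚ + q ^ k) * X))
               (ℕP.*-distribʳ-+ k b (suc s)) (inv-distrib-* (Q ^ (2 ℕ.* s ℕ.+ 1)) (Q ^ a)) ⟩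
    q ^ (k ℕ.* k) * (q ^ (b ℕ.* k ℕ.+ suc s ℕ.* k) * (1ℚ + q ^ k) * (inv (Q ^ (2 ℕ.* s ℕ.+ 1)) * inv (Q ^ a)))
      ≡⟨ cong (λ X → q ^ (k ℕ.* k) * (X * (1ℚ + q ^ k) * (inv (Q ^ (2 ℕ.* s ℕ.+ 1)) * inv (Q ^ a))))
              (^-distribˡ-+-* q (b ℕ.* k) (suc s ℕ.* k)) ⟩
    q ^ (k ℕ.* k) * (q ^ (b ℕ.* k) * q ^ (suc s ℕ.* k) * (1ℚ + q ^ k) * (inv (Q ^ (2 ℕ.* s ℕ.+ 1)) * inv (Q ^ a)))
      ≡⟨ regroup (q ^ (k ℕ.* k)) (q ^ (b ℕ.* k)) (q ^ (suc s ℕ.* k)) (1ℚ + q ^ k) (inv (Q ^ (2 ℕ.* s ℕ.+ 1))) (inv (Q ^ a)) ⟩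
    q ^ (b ℕ.* k) * (1ℚ + q ^ k) * inv (Q ^ a) * plusWeight s k
      ≡⟨ cong (λ e → q ^ℤ e * (1ℚ + q ^ k) * inv (Q ^ a) * plusWeight s k) (sym ([1+m-1]*k b k)) ⟩
    term q (+ a) (+ suc b) k * plusWeight s k ∎
    where
    Q : ℚ
    Q = qint q k
    s+1+[1+b]≡1+[b+[1+s]] : s ℕ.+ 1 ℕ.+ suc b ≡ suc (b ℕ.+ suc s)
    s+1+[1+b]≡1+[b+[1+s]] = trans (ℕP.+-suc (s ℕ.+ 1) b) (cong suc (trans (ℕP.+-comm (s ℕ.+ 1) b) (cong (b ℕ.+_) (ℕP.+-comm s 1))))
    regroup : ∀ K B S Y iX iA → K * (B * S * Y * (iX * iA)) ≡ B * Y * iA * (K * (S * iX))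
    regroup = solve 6 (λ K B S Y iX iA → K :* (B :* S :* Y :* (iX :* iA)) := B :* Y :* iA :* (K :* (S :* iX))) refl

  module _ (0<q : 0ℚ < q) (q<1 : q < 1ℚ) where

    q^[1+i]<1 : ∀ i → q ^ suc i < 1ℚ
    q^[1+i]<1 zero    = subst (_< 1ℚ) (sym (ℚP.*-identityʳ q)) q<1
    q^[1+i]<1 (suc i) = ℚP.<-trans
      (subst (q * q ^ suc i <_) (ℚP.*-identityʳ q) (ℚP.*-monoʳ-<-pos q {{ℚ.positive 0<q}} (q^[1+i]<1 i))) q<1

    1-q^[1+i]-pos : ∀ i → 0ℚ < 1ℚ - q ^ suc i
    1-q^[1+i]-pos i = <1⇒0<1- (q^[1+i]<1 i)

    qint-pos : ∀ k → 0ℚ < qint q (suc k)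
    qint-pos k = *-pos (1-q^[1+i]-pos k) (inv-pos (<1⇒0<1- q<1))

    qpoch-pos : ∀ n → 0ℚ < qpoch q n
    qpoch-pos zero    = ℚP.positive⁻¹ 1ℚ
    qpoch-pos (suc n) = *-pos (qpoch-pos n) (1-q^[1+i]-pos n)

    private
      P iP : ℕ → ℚ
      P = qpoch q
      iP n = inv (P n)

      P≢0 : ∀ n → P n ≢ 0ℚ
      P≢0 n = pos⇒≢0 (qpoch-pos n)

      1-q^[1+i]≢0 : ∀ i → 1ℚ - q ^ suc i ≢ 0ℚ
      1-q^[1+i]≢0 i = pos⇒≢0 (1-q^[1+i]-pos i)

      [1+k]≢0 : ∀ k → qint q (suc k) ≢ 0ℚ
      [1+k]≢0 k = pos⇒≢0 (qint-pos k)

      iP-suc : ∀ m → iP (suc m) ≡ iP m * inv (1ℚ - q ^ suc m)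
      iP-suc m = inv-distrib-* (P m) (1ℚ - q ^ suc m)

    ρ-closed : ∀ {n k} → k ℕ.≤ n → ρ n k ≡ P n * P n * iP (n ℕ.∸ k) * iP (n ℕ.+ k)
    ρ-closed {n} {k} k≤n = begin
      ρ n k
        ≡⟨ cong₂ (λ x y → x * inv y) (qbinom-≤ k≤n) (qbinom-≤ (ℕP.m≤n+m k n)) ⟩
      P n * inv (P k * P (n ℕ.∸ k)) * inv (P (n ℕ.+ k) * inv (P k * P (n ℕ.+ k ℕ.∸ k)))
        ≡⟨ cong (λ m → P n * inv (P k * P (n ℕ.∸ k)) * inv (P (n ℕ.+ k) * inv (P k * P m))) (ℕP.m+n∸n≡m n k) ⟩
      P n * inv (P k * P (n ℕ.∸ k)) * inv (P (n ℕ.+ k) * inv (P k * P n))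
        ≡⟨ cong₂ (λ x y → P n * x * y) (inv-distrib-* (P k) (P (n ℕ.∸ k)))
             (trans (inv-distrib-* (P (n ℕ.+ k)) (inv (P k * P n))) (cong (iP (n ℕ.+ k) *_) (inv-involutive (P k * P n)))) ⟩
      P n * (iP k * iP (n ℕ.∸ k)) * (iP (n ℕ.+ k) * (P k * P n))
        ≡⟨ regroup (P n) (P k) (iP k) (iP (n ℕ.∸ k)) (iP (n ℕ.+ k)) ⟩
      K * (P k * iP k)
        ≡⟨ cong (K *_) (inv-inverseʳ (P k) (P≢0 k)) ⟩
      K * 1ℚ
        ≡⟨ ℚP.*-identityʳ K ⟩
      K ∎
      where
      K : ℚ
      K = P n * P n * iP (n ℕ.∸ k) * iP (n ℕ.+ k)
      regroup : ∀ a b ib c id → a * (ib * c) * (id * (b * a)) ≡ (a * a * c * id) * (b * ib)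
      regroup = solve 5 (λ a b ib c id → a :* (ib :* c) :* (id :* (b :* a)) := (a :* a :* c :* id) :* (b :* ib)) refl

    ρ-at-0 : ∀ n → ρ n 0 ≡ 1ℚ
    ρ-at-0 n = cong₂ (λ x y → x * inv y) (qbinom-at-0 n) (qbinom-at-0 (n ℕ.+ 0))
      where
      qbinom-at-0 : ∀ m → qbinom q m 0 ≡ 1ℚ
      qbinom-at-0 m = trans (qbinom-≤ {m} {0} z≤n)
                            (trans (cong (λ z → P m * inv z) (ℚP.*-identityˡ (P m))) (inv-inverseʳ (P m) (P≢0 m)))

    private
      module ρ-step-≤ (j d : ℕ) where
        n : ℕ
        x y : ℚ
        n = j ℕ.+ d
        x = q ^ suc d
        y = q ^ j

        q^[1+n]≡xy : q ^ suc n ≡ x * y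
        q^[1+n]≡xy = trans (cong (λ m → q ^ suc m) (ℕP.+-comm j d)) (^-distribˡ-+-* q (suc d) j)

        q^[1+n+j]≡xyy : q ^ suc (n ℕ.+ j) ≡ x * y * y
        q^[1+n+j]≡xyy = trans (cong (λ m → q ^ suc (m ℕ.+ j)) (ℕP.+-comm j d))
                              (trans (^-distribˡ-+-* q (suc d ℕ.+ j) j) (cong (_* y) (^-distribˡ-+-* q (suc d) j)))

        ρ-suc : ρ (suc n) j ≡ ρ n j * ((1ℚ - x * y) * (1ℚ - x * y)) * inv (1ℚ - x) * inv (1ℚ - x * y * y)
        ρ-suc = begin
          ρ (suc n) j
            ≡⟨ ρ-closed (ℕP.m≤n⇒m≤1+n (ℕP.m≤m+n j d)) ⟩
          P (suc n) * P (suc n) * iP (suc n ℕ.∸ j) * iP (suc n ℕ.+ j)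
            ≡⟨ cong (λ m → P (suc n) * P (suc n) * iP m * iP (suc n ℕ.+ j)) [1+n]∸j≡1+d ⟩
          P (suc n) * P (suc n) * iP (suc d) * iP (suc (n ℕ.+ j))
            ≡⟨ cong₂ (λ A B → P (suc n) * P (suc n) * A * B) (iP-suc d) (iP-suc (n ℕ.+ j)) ⟩
          (P n * (1ℚ - q ^ suc n)) * (P n * (1ℚ - q ^ suc n)) * (iP d * inv (1ℚ - x)) * (iP (n ℕ.+ j) * inv (1ℚ - q ^ suc (n ℕ.+ j)))
            ≡⟨ cong₂ (λ A B → (P n * (1ℚ - A)) * (P n * (1ℚ - A)) * (iP d * inv (1ℚ - x)) * (iP (n ℕ.+ j) * inv (1ℚ - B)))
                     q^[1+n]≡xy q^[1+n+j]≡xyy ⟩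
          (P n * (1ℚ - x * y)) * (P n * (1ℚ - x * y)) * (iP d * inv (1ℚ - x)) * (iP (n ℕ.+ j) * inv (1ℚ - x * y * y))
            ≡⟨ regroup (P n) (x * y) (iP d) (inv (1ℚ - x)) (iP (n ℕ.+ j)) (inv (1ℚ - x * y * y)) ⟩
          P n * P n * iP d * iP (n ℕ.+ j) * ((1ℚ - x * y) * (1ℚ - x * y)) * inv (1ℚ - x) * inv (1ℚ - x * y * y)
            ≡⟨ cong (λ m → P n * P n * iP m * iP (n ℕ.+ j) * ((1ℚ - x * y) * (1ℚ - x * y)) * inv (1ℚ - x) * inv (1ℚ - x * y * y))
                    (sym (ℕP.m+n∸m≡n j d)) ⟩
          P n * P n * iP (n ℕ.∸ j) * iP (n ℕ.+ j) * ((1ℚ - x * y) * (1ℚ - x * y)) * inv (1ℚ - x) * inv (1ℚ - x * y * y)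
            ≡⟨ cong (λ K → K * ((1ℚ - x * y) * (1ℚ - x * y)) * inv (1ℚ - x) * inv (1ℚ - x * y * y))
                    (sym (ρ-closed (ℕP.m≤m+n j d))) ⟩
          ρ n j * ((1ℚ - x * y) * (1ℚ - x * y)) * inv (1ℚ - x) * inv (1ℚ - x * y * y) ∎
          where
          [1+n]∸j≡1+d : suc n ℕ.∸ j ≡ suc d
          [1+n]∸j≡1+d = trans (ℕP.+-∸-assoc 1 (ℕP.m≤m+n j d)) (cong suc (ℕP.m+n∸m≡n j d))
          regroup : ∀ a z b r c s → (a * (1ℚ - z)) * (a * (1ℚ - z)) * (b * r) * (c * s) ≡ a * a * b * c * ((1ℚ - z) * (1ℚ - z)) * r * s
          regroup = solve 6 (λ a z b r c s → (a :* (con 1ℚ :- z)) :* (a :* (con 1ℚ :- z)) :* (b :* r) :* (c :* s)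
                                          := a :* a :* b :* c :* ((con 1ℚ :- z) :* (con 1ℚ :- z)) :* r :* s) refl

        ρ-step : 1 ℕ.≤ j → ρ (suc n) j * w₂ j ≡ ρ n j * w₂ j + w₂ (suc n) * ρ (suc n) j
        ρ-step (s≤s {n = j′} _) = begin
          ρ (suc n) j * w₂ j
            ≡⟨ cong₂ _*_ ρ-suc (w₂≡ j) ⟩
          ρ′ * (y * (i₁ * i₁))
            ≡⟨ ρ-step-identity (ρ n j) x y (inv (1ℚ - x)) (inv (1ℚ - x * y * y)) (inv (1ℚ - q)) i₁ i₂ r≡ s≡ i₁≡ i₂≡ ⟩
          ρ n j * (y * (i₁ * i₁)) + (x * y) * (i₂ * i₂) * ρ′
            ≡⟨ cong₂ (λ A B → ρ n j * A + B * ρ′) (sym (w₂≡ j)) (sym w₂[1+n]≡) ⟩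
          ρ n j * w₂ j + w₂ (suc n) * ρ′
            ≡⟨ cong (λ A → ρ n j * w₂ j + w₂ (suc n) * A) (sym ρ-suc) ⟩
          ρ n j * w₂ j + w₂ (suc n) * ρ (suc n) j ∎
          where
          ρ′ i₁ i₂ : ℚ
          ρ′ = ρ n j * ((1ℚ - x * y) * (1ℚ - x * y)) * inv (1ℚ - x) * inv (1ℚ - x * y * y)
          i₁ = inv (qint q j)
          i₂ = inv (qint q (suc n))
          r≡ : inv (1ℚ - x) * (1ℚ - x) ≡ 1ℚ
          r≡ = inv-inverseˡ (1ℚ - x) (1-q^[1+i]≢0 d)
          s≡ : inv (1ℚ - x * y * y) * (1ℚ - x * y * y) ≡ 1ℚ
          s≡ = inv-inverseˡ (1ℚ - x * y * y) (subst (λ z → 1ℚ - z ≢ 0ℚ) q^[1+n+j]≡xyy (1-q^[1+i]≢0 (n ℕ.+ j)))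
          i₁≡ : i₁ * ((1ℚ - y) * inv (1ℚ - q)) ≡ 1ℚ
          i₁≡ = inv-inverseˡ (qint q j) ([1+k]≢0 j′)
          i₂≡ : i₂ * ((1ℚ - x * y) * inv (1ℚ - q)) ≡ 1ℚ
          i₂≡ = subst (λ z → i₂ * ((1ℚ - z) * inv (1ℚ - q)) ≡ 1ℚ) q^[1+n]≡xy (inv-inverseˡ (qint q (suc n)) ([1+k]≢0 n))
          w₂[1+n]≡ : w₂ (suc n) ≡ (x * y) * (i₂ * i₂)
          w₂[1+n]≡ = trans (w₂≡ (suc n)) (cong (_* (i₂ * i₂)) q^[1+n]≡xy)

    ρ-step : ∀ n j → 1 ℕ.≤ j → ρ (suc n) j * w₂ j ≡ ρ n j * w₂ j + w₂ (suc n) * ρ (suc n) j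
    ρ-step n j 1≤j with j ℕ.≤? n
    ... | yes j≤n with ℕP.m≤n⇒∃[o]m+o≡n j≤n
    ...   | d , refl = ρ-step-≤.ρ-step j d 1≤j
    ρ-step n j 1≤j | no j≰n = begin
      ρ (suc n) j * w₂ j                         ≡⟨ beyond (ℕP.m≤n⇒m<n∨m≡n (ℕP.≰⇒> j≰n)) ⟩
      w₂ (suc n) * ρ (suc n) j                   ≡⟨ sym (ℚP.+-identityˡ (w₂ (suc n) * ρ (suc n) j)) ⟩
      0ℚ + w₂ (suc n) * ρ (suc n) j              ≡⟨ cong (_+ w₂ (suc n) * ρ (suc n) j) (sym ρnj*w₂j≡0) ⟩
      ρ n j * w₂ j + w₂ (suc n) * ρ (suc n) j    ∎
      where
      ρnj*w₂j≡0 : ρ n j * w₂ j ≡ 0ℚ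
      ρnj*w₂j≡0 = trans (cong (_* w₂ j) (ρ-vanish (ℕP.≰⇒> j≰n))) (ℚP.*-zeroˡ (w₂ j))
      beyond : suc n ℕ.< j ⊎ suc n ≡ j → ρ (suc n) j * w₂ j ≡ w₂ (suc n) * ρ (suc n) j
      beyond (inj₂ refl) = ℚP.*-comm (ρ (suc n) (suc n)) (w₂ (suc n))
      beyond (inj₁ 1+n<j) = begin
        ρ (suc n) j * w₂ j         ≡⟨ trans (cong (_* w₂ j) (ρ-vanish 1+n<j)) (ℚP.*-zeroˡ (w₂ j)) ⟩
        0ℚ                         ≡⟨ sym (trans (cong (w₂ (suc n) *_) (ρ-vanish 1+n<j)) (ℚP.*-zeroʳ (w₂ (suc n)))) ⟩
        w₂ (suc n) * ρ (suc n) j   ∎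

    ρ-shift : ∀ i d → let N = suc (i ℕ.+ d) in
      ρ N i * (1ℚ - q ^ suc d) ≡ ρ N (suc i) * (1ℚ - q ^ suc (N ℕ.+ i))
    ρ-shift i d = begin
      ρ N i * (1ℚ - q ^ suc d)
        ≡⟨ cong (_* (1ℚ - q ^ suc d)) (ρ-closed (ℕP.m≤n⇒m≤1+n (ℕP.m≤m+n i d))) ⟩
      P N * P N * iP (N ℕ.∸ i) * iP (N ℕ.+ i) * (1ℚ - q ^ suc d)
        ≡⟨ cong (λ m → P N * P N * iP m * iP (N ℕ.+ i) * (1ℚ - q ^ suc d)) N∸i≡1+d ⟩
      P N * P N * iP (suc d) * iP (N ℕ.+ i) * (1ℚ - q ^ suc d)
        ≡⟨ cong (λ z → P N * P N * z * iP (N ℕ.+ i) * (1ℚ - q ^ suc d)) (iP-suc d) ⟩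
      P N * P N * (iP d * inv (1ℚ - q ^ suc d)) * iP (N ℕ.+ i) * (1ℚ - q ^ suc d)
        ≡⟨ cancel-and-restore (P N * P N) (iP d) (iP (N ℕ.+ i)) (q ^ suc d) (q ^ suc (N ℕ.+ i))
             (inv-inverseˡ _ (1-q^[1+i]≢0 d)) (inv-inverseˡ _ (1-q^[1+i]≢0 (N ℕ.+ i))) ⟩
      P N * P N * iP d * (iP (N ℕ.+ i) * inv (1ℚ - q ^ suc (N ℕ.+ i))) * (1ℚ - q ^ suc (N ℕ.+ i))
        ≡⟨ cong (λ z → P N * P N * iP d * z * (1ℚ - q ^ suc (N ℕ.+ i))) (sym (iP-suc (N ℕ.+ i))) ⟩
      P N * P N * iP d * iP (suc (N ℕ.+ i)) * (1ℚ - q ^ suc (N ℕ.+ i))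
        ≡⟨ cong₂ (λ m m′ → P N * P N * iP m * iP m′ * (1ℚ - q ^ suc (N ℕ.+ i)))
                 (sym (ℕP.m+n∸m≡n i d)) (sym (ℕP.+-suc N i)) ⟩
      P N * P N * iP (N ℕ.∸ suc i) * iP (N ℕ.+ suc i) * (1ℚ - q ^ suc (N ℕ.+ i))
        ≡⟨ cong (_* (1ℚ - q ^ suc (N ℕ.+ i))) (sym (ρ-closed (s≤s (ℕP.m≤m+n i d)))) ⟩
      ρ N (suc i) * (1ℚ - q ^ suc (N ℕ.+ i)) ∎
      where
      N : ℕ
      N = suc (i ℕ.+ d)
      N∸i≡1+d : N ℕ.∸ i ≡ suc d
      N∸i≡1+d = trans (ℕP.+-∸-assoc 1 (ℕP.m≤m+n i d)) (cong suc (ℕP.m+n∸m≡n i d))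
      cancel-and-restore : ∀ A a b X Y {r s} → r * (1ℚ - X) ≡ 1ℚ → s * (1ℚ - Y) ≡ 1ℚ
        → A * (a * r) * b * (1ℚ - X) ≡ A * a * (b * s) * (1ℚ - Y)
      cancel-and-restore A a b X Y {r} {s} r≡ s≡ = begin
        A * (a * r) * b * (1ℚ - X)   ≡⟨ pull A a r b X ⟩
        A * a * b * (r * (1ℚ - X))   ≡⟨ cong (A * a * b *_) (trans r≡ (sym s≡)) ⟩
        A * a * b * (s * (1ℚ - Y))   ≡⟨ sym (pull′ A a s b Y) ⟩
        A * a * (b * s) * (1ℚ - Y)   ∎
        where
        pull : ∀ A a r b X → A * (a * r) * b * (1ℚ - X) ≡ A * a * b * (r * (1ℚ - X))
        pull = solve 5 (λ A a r b X → A :* (a :* r) :* b :* (con 1ℚ :- X) := A :* a :* b :* (r :* (con 1ℚ :- X))) refl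
        pull′ : ∀ A a s b Y → A * a * (b * s) * (1ℚ - Y) ≡ A * a * b * (s * (1ℚ - Y))
        pull′ = solve 5 (λ A a s b Y → A :* a :* (b :* s) :* (con 1ℚ :- Y) := A :* a :* b :* (s :* (con 1ℚ :- Y))) refl

    -- For s = 0 the comma weights are w₂ j · V j, and ρ N j · V j telescopes.
    V : ℕ → ℚ
    V j = q ^ ((j ℕ.∸ 1) ℕ.* j) * (1ℚ + q ^ j) * qint q j

    D : ℕ → ℕ → ℚ
    D N j = q ^ (j ℕ.* j) * ρ N j * (qint q N - qint q j)

    ρV-telescopes : ∀ N j → 1 ℕ.≤ j → j ℕ.≤ N → ρ N j * V j ≡ D N (j ℕ.∸ 1) - D N j
    ρV-telescopes N (suc i) _ 1+i≤N with ℕP.m≤n⇒∃[o]m+o≡n 1+i≤N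
    ... | d , refl = begin
      ρ N (suc i) * (q ^ (i ℕ.* suc i) * (1ℚ + q * X) * ((1ℚ - q * X) * u))
        ≡⟨ cong (λ A → ρ N (suc i) * (A * (1ℚ + q * X) * ((1ℚ - q * X) * u))) q^[i*[1+i]] ⟩
      ρ N (suc i) * ((X * W) * (1ℚ + q * X) * ((1ℚ - q * X) * u))
        ≡⟨ ρV-telescoping-identity q X Z W u (ρ N i) (ρ N (suc i)) shift ⟩
      W * ρ N i * ((1ℚ - X * Z) * u - (1ℚ - X) * u) - (q * X * (X * W)) * ρ N (suc i) * ((1ℚ - X * Z) * u - (1ℚ - q * X) * u)
        ≡⟨ cong₂ (λ A B → W * ρ N i * ((1ℚ - A) * u - (1ℚ - X) * u) - B * ρ N (suc i) * ((1ℚ - A) * u - (1ℚ - q * X) * u))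
                 (sym q^N) (sym q^[[1+i]*[1+i]]) ⟩
      D N i - D N (suc i) ∎
      where
      X : ℚ
      X = q ^ i
      Z : ℚ
      Z = q ^ suc d
      W : ℚ
      W = q ^ (i ℕ.* i)
      u : ℚ
      u = inv (1ℚ - q)
      q^N : q ^ N ≡ X * Z
      q^N = trans (cong (q ^_) (sym (ℕP.+-suc i d))) (^-distribˡ-+-* q i (suc d))
      q^[i*[1+i]] : q ^ (i ℕ.* suc i) ≡ X * W
      q^[i*[1+i]] = trans (cong (q ^_) (ℕP.*-suc i i)) (^-distribˡ-+-* q i (i ℕ.* i))
      q^[[1+i]*[1+i]] : q ^ (suc i ℕ.* suc i) ≡ q * X * (X * W)
      q^[[1+i]*[1+i]] = trans (^-distribˡ-+-* q (suc i) (i ℕ.* suc i)) (cong (q * X *_) q^[i*[1+i]])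
      shift : ρ N i * (1ℚ - Z) ≡ ρ N (suc i) * (1ℚ - X * Z * (q * X))
      shift = trans (ρ-shift i d) (cong (λ z → ρ N (suc i) * (1ℚ - z))
                (trans (cong (q ^_) (sym (ℕP.+-suc N i))) (trans (^-distribˡ-+-* q N (suc i)) (cong (_* (q * X)) q^N))))
    Σ>-ρV : ∀ N k → Σ> k N (λ j → ρ N j * V j) ≡ D N k
    Σ>-ρV N k with k ℕ.≤? N
    ... | yes k≤N = begin
      Σ> k N (λ j → ρ N j * V j)
        ≡⟨ Σ>-telescope k N (λ j → ρ N j * V j) (D N) k≤N
             (λ j k<j j≤N → ρV-telescopes N j (ℕP.≤-trans (s≤s z≤n) k<j) j≤N) ⟩
      D N k - D N N
        ≡⟨ cong (_-_ (D N k)) (trans (cong (q ^ (N ℕ.* N) * ρ N N *_) (ℚP.+-inverseʳ (qint q N)))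
                                     (ℚP.*-zeroʳ (q ^ (N ℕ.* N) * ρ N N))) ⟩
      D N k - 0ℚ
        ≡⟨ ℚP.+-identityʳ (D N k) ⟩
      D N k ∎
    ... | no k≰N = trans (Σ>-vanish k N _ (ℕP.<⇒≤ (ℕP.≰⇒> k≰N)))
      (sym (trans (cong (λ r → q ^ (k ℕ.* k) * r * (qint q N - qint q k)) (ρ-vanish (ℕP.≰⇒> k≰N)))
                  (trans (cong (_* (qint q N - qint q k)) (ℚP.*-zeroʳ (q ^ (k ℕ.* k)))) (ℚP.*-zeroˡ (qint q N - qint q k)))))

    w₂*qint≡w₁ : ∀ i → w₂ (suc i) * qint q (suc i) ≡ w₁ (suc i)
    w₂*qint≡w₁ i = begin
      w₂ k * Q                      ≡⟨ cong (_* Q) (w₂≡ k) ⟩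
      q ^ k * (inv Q * inv Q) * Q   ≡⟨ regroup (q ^ k) (inv Q) Q ⟩
      q ^ k * inv Q * (inv Q * Q)   ≡⟨ cong (q ^ k * inv Q *_) (inv-inverseˡ Q ([1+k]≢0 i)) ⟩
      q ^ k * inv Q * 1ℚ            ≡⟨ trans (ℚP.*-identityʳ _) (sym (w₁≡ k)) ⟩
      w₁ k                          ∎
      where
      k : ℕ
      k = suc i
      Q : ℚ
      Q = qint q k
      regroup : ∀ a i Q → a * (i * i) * Q ≡ a * i * (i * Q)
      regroup = solve 3 (λ a i Q → a :* (i :* i) :* Q := a :* i :* (i :* Q)) refl

    plusWeight-0-suc : ∀ i → plusWeight 0 (suc i) ≡ w₂ (suc i) * (q ^ (suc i ℕ.* suc i) * qint q (suc i))
    plusWeight-0-suc i = begin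
      q ^ (k ℕ.* k) * (q ^ (k ℕ.+ 0) * inv (qint q k * 1ℚ))
        ≡⟨ cong (λ m → q ^ (k ℕ.* k) * (q ^ m * inv (qint q k * 1ℚ))) (ℕP.+-identityʳ k) ⟩
      q ^ (k ℕ.* k) * w₁ k
        ≡⟨ cong (q ^ (k ℕ.* k) *_) (sym (w₂*qint≡w₁ i)) ⟩
      q ^ (k ℕ.* k) * (w₂ k * qint q k)
        ≡⟨ *-left-comm (q ^ (k ℕ.* k)) (w₂ k) (qint q k) ⟩
      w₂ k * (q ^ (k ℕ.* k) * qint q k) ∎
      where k : ℕ
            k = suc i

    commaWeight-0-suc : ∀ i → commaWeight 0 (suc i) ≡ w₂ (suc i) * V (suc i)
    commaWeight-0-suc i = begin
      q ^ (j ℕ.+ i ℕ.* j) * (1ℚ * (1ℚ + q ^ j) * inv (Q * 1ℚ))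
        ≡⟨ cong₂ (λ A B → A * (1ℚ * (1ℚ + q ^ j) * B))
                 (^-distribˡ-+-* q j (i ℕ.* j)) (trans (inv-distrib-* Q 1ℚ) (ℚP.*-identityʳ (inv Q))) ⟩
      q ^ j * q ^ (i ℕ.* j) * (1ℚ * (1ℚ + q ^ j) * inv Q)
        ≡⟨ sym (ℚP.*-identityʳ _) ⟩
      q ^ j * q ^ (i ℕ.* j) * (1ℚ * (1ℚ + q ^ j) * inv Q) * 1ℚ
        ≡⟨ cong (q ^ j * q ^ (i ℕ.* j) * (1ℚ * (1ℚ + q ^ j) * inv Q) *_) (sym (inv-inverseˡ Q ([1+k]≢0 i))) ⟩
      q ^ j * q ^ (i ℕ.* j) * (1ℚ * (1ℚ + q ^ j) * inv Q) * (inv Q * Q)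
        ≡⟨ regroup (q ^ j) (q ^ (i ℕ.* j)) (1ℚ + q ^ j) (inv Q) Q ⟩
      q ^ j * (inv Q * inv Q) * (q ^ (i ℕ.* j) * (1ℚ + q ^ j) * Q)
        ≡⟨ cong (_* V j) (sym (w₂≡ j)) ⟩
      w₂ j * V j ∎
      where
      j : ℕ
      j = suc i
      Q : ℚ
      Q = qint q j
      regroup : ∀ a b c i Q → a * b * (1ℚ * c * i) * (i * Q) ≡ a * (i * i) * (b * c * Q)
      regroup = solve 5 (λ a b c i Q → a :* b :* (con 1ℚ :* c :* i) :* (i :* Q) := a :* (i :* i) :* (b :* c :* Q)) refl

    ρ-step-scaled : ∀ n j {X Y} → 1 ℕ.≤ j → X ≡ w₂ j * Y →
      ρ (suc n) j * X ≡ ρ n j * X + w₂ (suc n) * (ρ (suc n) j * Y)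
    ρ-step-scaled n j {Y = Y} 1≤j refl = begin
      ρ (suc n) j * (w₂ j * Y)                            ≡⟨ sym (ℚP.*-assoc (ρ (suc n) j) (w₂ j) Y) ⟩
      ρ (suc n) j * w₂ j * Y                              ≡⟨ cong (_* Y) (ρ-step n j 1≤j) ⟩
      (ρ n j * w₂ j + w₂ (suc n) * ρ (suc n) j) * Y       ≡⟨ distribute (ρ n j) (w₂ j) (w₂ (suc n)) (ρ (suc n) j) Y ⟩
      ρ n j * (w₂ j * Y) + w₂ (suc n) * (ρ (suc n) j * Y) ∎
      where
      distribute : ∀ a b c d e → (a * b + c * d) * e ≡ a * (b * e) + c * (d * e)
      distribute = solve 5 (λ a b c d e → (a :* b :+ c :* d) :* e := a :* (b :* e) :+ c :* (d :* e)) refl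

    private
      ρ-step-trivial : ∀ n {X Y} → X ≡ 0ℚ → Y ≡ 0ℚ →
        ρ (suc n) 0 * X ≡ ρ n 0 * X + w₂ (suc n) * (ρ (suc n) 0 * Y)
      ρ-step-trivial n refl refl = zeros (ρ (suc n) 0) (ρ n 0) (w₂ (suc n))
        where
        zeros : ∀ a b c → a * 0ℚ ≡ b * 0ℚ + c * (a * 0ℚ)
        zeros = solve 3 (λ a b c → a :* con 0ℚ := b :* con 0ℚ :+ c :* (a :* con 0ℚ)) refl

      regroup : ∀ A B C D w → (A + w * B) + (C + w * D) ≡ (A + C) + w * (B + D)
      regroup = solve 5 (λ A B C D w → (A :+ w :* B) :+ (C :+ w :* D) := (A :+ C) :+ w :* (B :+ D)) refl

    Σ>-ρ-step : ∀ n k (X Y : ℕ → ℚ) → (∀ j → 1 ℕ.≤ j → X j ≡ w₂ j * Y j) →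
      Σ> k (suc n) (λ j → ρ (suc n) j * X j)
        ≡ Σ> k n (λ j → ρ n j * X j) + w₂ (suc n) * Σ> k (suc n) (λ j → ρ (suc n) j * Y j)
    Σ>-ρ-step n k X Y X≡w₂Y = begin
      Σ> k (suc n) (λ j → ρ (suc n) j * X j)
        ≡⟨ Σ>-cong k (suc n) (λ j 1≤j _ → ρ-step-scaled n j 1≤j (X≡w₂Y j 1≤j)) ⟩
      Σ> k (suc n) (λ j → ρ n j * X j + w₂ (suc n) * (ρ (suc n) j * Y j))
        ≡⟨ Σ>-linear k (suc n) (w₂ (suc n)) (λ j → ρ n j * X j) (λ j → ρ (suc n) j * Y j) ⟩
      Σ> k (suc n) (λ j → ρ n j * X j) + w₂ (suc n) * Σ> k (suc n) (λ j → ρ (suc n) j * Y j)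
        ≡⟨ cong (_+ w₂ (suc n) * Σ> k (suc n) (λ j → ρ (suc n) j * Y j))
                (Σ>-drop-last k n (λ j → ρ n j * X j) (trans (cong (_* X (suc n)) (ρ-vanish (ℕP.n<1+n n))) (ℚP.*-zeroˡ (X (suc n))))) ⟩
      Σ> k n (λ j → ρ n j * X j) + w₂ (suc n) * Σ> k (suc n) (λ j → ρ (suc n) j * Y j) ∎

    Φ : ℕ → ℕ → ℕ → ℚ
    Φ s n k = ρ n k * plusWeight s k + Σ> k n (λ j → ρ n j * commaWeight s j)

    Φ-0 : ∀ s k → Φ s 0 k ≡ 0ℚ
    Φ-0 s zero    = trans (ℚP.+-identityʳ (ρ 0 0 * plusWeight s 0))
                          (trans (cong (ρ 0 0 *_) (plusWeight-0 s)) (ℚP.*-zeroʳ (ρ 0 0)))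
    Φ-0 s (suc k) = trans (ℚP.+-identityʳ (ρ 0 (suc k) * plusWeight s (suc k)))
                          (trans (cong (_* plusWeight s (suc k)) (ρ-vanish {0} {suc k} (s≤s z≤n))) (ℚP.*-zeroˡ (plusWeight s (suc k))))

    Φ-suc : ∀ s n k → Φ (suc s) (suc n) k ≡ Φ (suc s) n k + w₂ (suc n) * Φ s (suc n) k
    Φ-suc s n k = trans
      (cong₂ _+_ (plus-step k) (Σ>-ρ-step n k (commaWeight (suc s)) (commaWeight s) (λ j _ → commaWeight-suc s j)))
      (regroup (ρ n k * plusWeight (suc s) k) (ρ (suc n) k * plusWeight s k)
               (Σ> k n (λ j → ρ n j * commaWeight (suc s) j)) (Σ> k (suc n) (λ j → ρ (suc n) j * commaWeight s j)) (w₂ (suc n)))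
      where
      plus-step : ∀ k → ρ (suc n) k * plusWeight (suc s) k ≡ ρ n k * plusWeight (suc s) k + w₂ (suc n) * (ρ (suc n) k * plusWeight s k)
      plus-step zero    = ρ-step-trivial n (plusWeight-0 (suc s)) (plusWeight-0 s)
      plus-step (suc k) = ρ-step-scaled n (suc k) (s≤s z≤n) (plusWeight-suc s (suc k))

    Φ-zero-suc : ∀ n k → Φ 0 (suc n) k ≡ Φ 0 n k + q ^ (k ℕ.* k) * (w₁ (suc n) * ρ (suc n) k)
    Φ-zero-suc n k = begin
      Φ 0 (suc n) k
        ≡⟨ cong₂ _+_ (plus-step k)
             (trans (Σ>-ρ-step n k (commaWeight 0) V (λ { (suc i) _ → commaWeight-0-suc i }))
                    (cong (λ z → Σ> k n (λ j → ρ n j * commaWeight 0 j) + w₂ (suc n) * z) (Σ>-ρV (suc n) k))) ⟩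
      (ρ n k * plusWeight 0 k + w₂ (suc n) * (ρ (suc n) k * (Qk * qint q k)))
        + (Σ> k n (λ j → ρ n j * commaWeight 0 j) + w₂ (suc n) * D (suc n) k)
        ≡⟨ regroup (ρ n k * plusWeight 0 k) (ρ (suc n) k * (Qk * qint q k))
                   (Σ> k n (λ j → ρ n j * commaWeight 0 j)) (D (suc n) k) (w₂ (suc n)) ⟩
      Φ 0 n k + w₂ (suc n) * (ρ (suc n) k * (Qk * qint q k) + Qk * ρ (suc n) k * (qint q (suc n) - qint q k))
        ≡⟨ cong (_+_ (Φ 0 n k)) (trans (telescoped (w₂ (suc n)) (ρ (suc n) k) Qk (qint q k) (qint q (suc n)))
                                    (cong (λ w → Qk * (w * ρ (suc n) k)) (w₂*qint≡w₁ n))) ⟩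
      Φ 0 n k + Qk * (w₁ (suc n) * ρ (suc n) k) ∎
      where
      Qk : ℚ
      Qk = q ^ (k ℕ.* k)
      plus-step : ∀ k → ρ (suc n) k * plusWeight 0 k ≡ ρ n k * plusWeight 0 k + w₂ (suc n) * (ρ (suc n) k * (q ^ (k ℕ.* k) * qint q k))
      plus-step zero    = ρ-step-trivial n (plusWeight-0 0) (trans (ℚP.*-identityˡ (qint q 0)) qint-0)
      plus-step (suc i) = ρ-step-scaled n (suc i) (s≤s z≤n) (plusWeight-0-suc i)
      telescoped : ∀ w r Q a b → w * (r * (Q * a) + Q * r * (b - a)) ≡ Q * ((w * b) * r)
      telescoped = solve 5 (λ w r Q a b → w :* (r :* (Q :* a) :+ Q :* r :* (b :- a)) := Q :* ((w :* b) :* r)) refl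

    nested-ρ : ∀ s n k → q ^ (k ℕ.* k) * nested s (λ l → ρ l k) n ≡ Φ s n k
    nested-ρ zero    zero    k = trans (ℚP.*-zeroʳ (q ^ (k ℕ.* k))) (sym (Φ-0 0 k))
    nested-ρ (suc s) zero    k = trans (ℚP.*-zeroʳ (q ^ (k ℕ.* k))) (sym (Φ-0 (suc s) k))
    nested-ρ zero    (suc n) k = begin
      Qk * (nested 0 (λ l → ρ l k) n + w₁ (suc n) * ρ (suc n) k)
        ≡⟨ ℚP.*-distribˡ-+ Qk _ _ ⟩
      Qk * nested 0 (λ l → ρ l k) n + Qk * (w₁ (suc n) * ρ (suc n) k)
        ≡⟨ cong (_+ Qk * (w₁ (suc n) * ρ (suc n) k)) (nested-ρ 0 n k) ⟩
      Φ 0 n k + Qk * (w₁ (suc n) * ρ (suc n) k)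
        ≡⟨ sym (Φ-zero-suc n k) ⟩
      Φ 0 (suc n) k ∎
      where Qk : ℚ
            Qk = q ^ (k ℕ.* k)
    nested-ρ (suc s) (suc n) k = begin
      Qk * (nested (suc s) (λ l → ρ l k) n + w₂ (suc n) * nested s (λ l → ρ l k) (suc n))
        ≡⟨ ℚP.*-distribˡ-+ Qk _ _ ⟩
      Qk * nested (suc s) (λ l → ρ l k) n + Qk * (w₂ (suc n) * nested s (λ l → ρ l k) (suc n))
        ≡⟨ cong₂ _+_ (nested-ρ (suc s) n k)
                     (trans (*-left-comm Qk (w₂ (suc n)) _) (cong (w₂ (suc n) *_) (nested-ρ s (suc n) k))) ⟩
      Φ (suc s) n k + w₂ (suc n) * Φ s (suc n) k
        ≡⟨ sym (Φ-suc s n k) ⟩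
      Φ (suc s) (suc n) k ∎
      where Qk : ℚ
            Qk = q ^ (k ℕ.* k)

    nested-hatH-summand : ∀ s a b n k c → 1 ℕ.≤ b →
      nested s (λ l → ρ l k * (q ^ (k ℕ.* k) * term q (+ a) (+ b) k) * c) n
        ≡ ρ n k * (q ^ (k ℕ.* k) * term q (+ (2 ℕ.* s ℕ.+ 1 ℕ.+ a)) (+ (s ℕ.+ 1 ℕ.+ b)) k) * c
          + (term q (+ a) (+ b) k * c) * Σ> k n (λ j → ρ n j * commaWeight s j)
    nested-hatH-summand s a b n k c 1≤b = begin
      nested s (λ l → ρ l k * (Qk * t) * c) n
        ≡⟨ nested-cong s n (λ l _ → ℚP.*-assoc (ρ l k) (Qk * t) c) ⟩
      nested s (λ l → ρ l k * ((Qk * t) * c)) n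
        ≡⟨ nested-*ʳ s n ((Qk * t) * c) (λ l → ρ l k) ⟩
      nested s (λ l → ρ l k) n * ((Qk * t) * c)
        ≡⟨ pull-Qk (nested s (λ l → ρ l k) n) Qk t c ⟩
      (Qk * nested s (λ l → ρ l k) n) * (t * c)
        ≡⟨ cong (_* (t * c)) (nested-ρ s n k) ⟩
      (ρ n k * plusWeight s k + Σ> k n (λ j → ρ n j * commaWeight s j)) * (t * c)
        ≡⟨ distribute (ρ n k) (plusWeight s k) (Σ> k n (λ j → ρ n j * commaWeight s j)) t c ⟩
      ρ n k * (t * plusWeight s k) * c + (t * c) * Σ> k n (λ j → ρ n j * commaWeight s j)
        ≡⟨ cong (λ z → ρ n k * z * c + (t * c) * Σ> k n (λ j → ρ n j * commaWeight s j)) (sym (term-plus s a b k 1≤b)) ⟩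
      ρ n k * (Qk * term q (+ (2 ℕ.* s ℕ.+ 1 ℕ.+ a)) (+ (s ℕ.+ 1 ℕ.+ b)) k) * c
        + (t * c) * Σ> k n (λ j → ρ n j * commaWeight s j) ∎
      where
      Qk t : ℚ
      Qk = q ^ (k ℕ.* k)
      t = term q (+ a) (+ b) k
      pull-Qk : ∀ W Q t c → W * ((Q * t) * c) ≡ (Q * W) * (t * c)
      pull-Qk = solve 4 (λ W Q t c → W :* ((Q :* t) :* c) := (Q :* W) :* (t :* c)) refl
      distribute : ∀ r p S t c → (r * p + S) * (t * c) ≡ r * (t * p) * c + (t * c) * S
      distribute = solve 5 (λ r p S t c → (r :* p :+ S) :* (t :* c) := r :* (t :* p) :* c :+ (t :* c) :* S) refl

    nested-hatH : ∀ s a b rest n → 1 ℕ.≤ b →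
      nested s (λ l → hatH q l ((+ a , + b) ∷ rest)) n
        ≡ hatH q n ((+ (2 ℕ.* s ℕ.+ 1 ℕ.+ a) , + (s ℕ.+ 1 ℕ.+ b)) ∷ rest) + hatH q n (pt s ∷ (+ a , + b) ∷ rest)
    nested-hatH s a b rest n 1≤b = begin
      nested s (λ l → hatH q l ((+ a , + b) ∷ rest)) n
        ≡⟨ nested-cong s n extend ⟩
      nested s (λ l → Σ1 n (F l)) n
        ≡⟨ nested-Σ1 s n n F ⟩
      Σ1 n (λ k → nested s (λ l → F l k) n)
        ≡⟨ Σ1-cong n (λ k _ _ → nested-hatH-summand s a b n k (c k) 1≤b) ⟩
      Σ1 n (λ k → ρ n k * (q ^ (k ℕ.* k) * glued k) * c k + (t k * c k) * Σ> k n g)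
        ≡⟨ Σ1-distrib-+ n _ _ ⟩
      H₊ + Σ1 n (λ k → (t k * c k) * Σ> k n g)
        ≡⟨ cong (_+_ H₊) (sym (Σ1-triangle n g (λ k → t k * c k))) ⟩
      H₊ + Σ1 n (λ j → g j * calH q (j ℕ.∸ 1) ((+ a , + b) ∷ rest))
        ≡⟨ cong (_+_ H₊) (Σ1-cong n (λ j _ _ →
             cong (λ z → ρ n j * z * calH q (j ℕ.∸ 1) ((+ a , + b) ∷ rest)) (sym (term-comma s j)))) ⟩
      H₊ + hatH q n (pt s ∷ (+ a , + b) ∷ rest) ∎
      where
      H₊ : ℚ
      H₊ = hatH q n ((+ (2 ℕ.* s ℕ.+ 1 ℕ.+ a) , + (s ℕ.+ 1 ℕ.+ b)) ∷ rest)
      t c glued g : ℕ → ℚ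
      t k = term q (+ a) (+ b) k
      c k = calH q (k ℕ.∸ 1) rest
      glued k = term q (+ (2 ℕ.* s ℕ.+ 1 ℕ.+ a)) (+ (s ℕ.+ 1 ℕ.+ b)) k
      g j = ρ n j * commaWeight s j
      F : ℕ → ℕ → ℚ
      F l k = ρ l k * (q ^ (k ℕ.* k) * t k) * c k
      extend : ∀ l → l ℕ.≤ n → hatH q l ((+ a , + b) ∷ rest) ≡ Σ1 n (F l)
      extend l l≤n = sym (trans (cong (λ m → Σ1 m (F l)) (sym (ℕP.m∸n+n≡m l≤n)))
        (Σ1-extend l (n ℕ.∸ l) (F l) (λ k l<k →
          trans (cong (λ r → r * (q ^ (k ℕ.* k) * t k) * c k) (ρ-vanish l<k)) (zero-left (q ^ (k ℕ.* k) * t k) (c k)))))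
        where
        zero-left : ∀ x y → 0ℚ * x * y ≡ 0ℚ
        zero-left = solve 2 (λ x y → con 0ℚ :* x :* y := con 0ℚ) refl

    nested-one : ∀ s n → nested s (λ _ → 1ℚ) n ≡ hatH q n (pt s ∷ [])
    nested-one s n = begin
      nested s (λ _ → 1ℚ) n
        ≡⟨ nested-cong s n (λ l _ → sym (ρ-at-0 l)) ⟩
      nested s (λ l → ρ l 0) n
        ≡⟨ sym (ℚP.*-identityˡ _) ⟩
      q ^ 0 * nested s (λ l → ρ l 0) n
        ≡⟨ nested-ρ s n 0 ⟩
      ρ n 0 * plusWeight s 0 + Σ> 0 n (λ j → ρ n j * commaWeight s j)
        ≡⟨ cong (λ z → ρ n 0 * z + Σ> 0 n (λ j → ρ n j * commaWeight s j)) (plusWeight-0 s) ⟩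
      ρ n 0 * 0ℚ + Σ> 0 n (λ j → ρ n j * commaWeight s j)
        ≡⟨ trans (cong (_+ Σ> 0 n (λ j → ρ n j * commaWeight s j)) (ℚP.*-zeroʳ (ρ n 0))) (ℚP.+-identityˡ _) ⟩
      Σ> 0 n (λ j → ρ n j * commaWeight s j)
        ≡⟨ Σ1-cong n (λ { (suc i) _ _ → trans (cong (ρ n (suc i) *_) (sym (term-comma s (suc i)))) (sym (ℚP.*-identityʳ _)) }) ⟩
      hatH q n (pt s ∷ []) ∎

    Hstar≡ΣhatH : ∀ m s₁ (ss : Vec ℕ m) n →
      Hstar q n (twosOnes (s₁ ∷ ss)) ≡ ΣBools m (λ ops → hatH q n (glue (pt s₁) (ptVec ss) ops))
    Hstar≡ΣhatH zero    s₁ []        n = trans (Hstar≡nested s₁ n []) (nested-one s₁ n)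
    Hstar≡ΣhatH (suc m) s₁ (s₂ ∷ ss) n = begin
      Hstar q n (twosOnes (s₁ ∷ s₂ ∷ ss))
        ≡⟨ Hstar≡nested s₁ n (twosOnes (s₂ ∷ ss)) ⟩
      nested s₁ (λ l → Hstar q l (twosOnes (s₂ ∷ ss))) n
        ≡⟨ nested-cong s₁ n (λ l _ → Hstar≡ΣhatH m s₂ ss l) ⟩
      nested s₁ (λ l → ΣBools m (λ v → hatH q l (glue (pt s₂) (ptVec ss) v))) n
        ≡⟨ nested-ΣBools s₁ n m (λ v l → hatH q l (glue (pt s₂) (ptVec ss) v)) ⟩
      ΣBools m (λ v → nested s₁ (λ l → hatH q l (glue (pt s₂) (ptVec ss) v)) n)
        ≡⟨ ΣBools-cong m plus-or-comma ⟩
      ΣBools m (λ v → hatH q n (glue (+ (2 ℕ.* s₁ ℕ.+ 1 ℕ.+ (2 ℕ.* s₂ ℕ.+ 1)) , + (s₁ ℕ.+ 1 ℕ.+ (s₂ ℕ.+ 1))) (ptVec ss) v)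
                    + hatH q n (pt s₁ ∷ glue (pt s₂) (ptVec ss) v))
        ≡⟨ ΣBools-distrib-+ m _ _ ⟩
      ΣBools (suc m) (λ ops → hatH q n (glue (pt s₁) (ptVec (s₂ ∷ ss)) ops)) ∎
      where
      plus-or-comma : ∀ v → nested s₁ (λ l → hatH q l (glue (pt s₂) (ptVec ss) v)) n
        ≡ hatH q n (glue (+ (2 ℕ.* s₁ ℕ.+ 1 ℕ.+ (2 ℕ.* s₂ ℕ.+ 1)) , + (s₁ ℕ.+ 1 ℕ.+ (s₂ ℕ.+ 1))) (ptVec ss) v)
          + hatH q n (pt s₁ ∷ glue (pt s₂) (ptVec ss) v)
      plus-or-comma v with glue-+head ss v (2 ℕ.* s₁ ℕ.+ 1) (s₁ ℕ.+ 1) (2 ℕ.* s₂ ℕ.+ 1) (s₂ ℕ.+ 1)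
      ... | a , b , rest , s₂+1≤b , glue-s₂ , glue-s₁+s₂ rewrite glue-s₂ | glue-s₁+s₂ =
        nested-hatH s₁ a b rest n (ℕP.≤-trans (subst (1 ℕ.≤_) (ℕP.+-comm 1 s₂) (s≤s z≤n)) s₂+1≤b)

-- The induction needs the identity at every l ≤ n, including l = 0 where both sides vanish.
theorem3p2 : (q : ℚ) → 0ℚ < q → q < 1ℚ →
    (m : ℕ) (s₁ : ℕ) (ss : Vec ℕ m) (n : ℕ) → n ≥ 1 →
    Hstar q n (twosOnes (s₁ ∷ ss))
      ≡ ΣBools m (λ ops → hatH q n (glue (pt s₁) (ptVec ss) ops))
theorem3p2 q 0<q q<1 m s₁ ss n _ = Hstar≡ΣhatH q 0<q q<1 m s₁ ss n
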